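{- Let $T$ be a tree with $n\ge 1$ vertices of degrees $k_1,\dots,k_n$, and write $n\langle k^2\rangle=\sum_{i=1}^n k_i^2$. Under a uniformly random linear arrangement of its vertices, the sum of edge lengths $D$ satisfies $$\mathbb{E}_{rla}[D^2]=\frac{n+1}{45}\left[(n-1)^2(5n+6)+\left(\frac n4-1\right)n\langle k^2\rangle\right],\qquad \mathbb{V}_{rla}[D]=\frac{n+1}{45}\left[(n-1)^2+\left(\frac n4-1\right)n\langle k^2\rangle\right].$$
   Context: A linear arrangement of the vertex set $V$ ($|V|=n$) is a bijection $\pi:V\to\{1,\dots,n\}$; the length of an edge $\{u,v\}$ is $|\pi(u)-\pi(v)|$; $D$ is the sum of the lengths of all edges. In a uniformly random linear arrangement $\pi$ is uniform over all $n!$ bijections; $\mathbb{E}_{rla}$ and $\mathbb{V}_{rla}$ denote expectation and variance with respect to this choice. $\langle k^2\rangle=\frac1n\sum_i k_i^2$. -}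

module Defs where

open import Data.Nat using (ℕ; zero; suc; _^_; _≤_; ∣_-_∣)
open import Data.Nat.ListAction using (sum)
open import Data.Fin using (Fin; toℕ)
open import Data.Fin.Properties using (_≟_)
open import Data.Product using (_×_; _,_; proj₁; proj₂; Σ; swap)
open import Data.Sum using (_⊎_)
open import Data.List using (List; []; _∷_; [_]; _++_; length; map; concatMap; filter; allFin)
open import Data.List.Relation.Unary.All using (All)
open import Data.List.Relation.Unary.AllPairs using (AllPairs)
open import Data.List.Membership.Propositional using (_∈_)
open import Data.List.Relation.Unary.Unique.Propositional using (Unique)
import Data.List.Relation.Unary.Unique.DecPropositional as UDec
open import Data.Vec using (Vec; lookup; toList) renaming ([] to []ᵥ; _∷_ to _∷ᵥ_)
open import Data.Integer using (+_)
open import Data.Rational using (ℚ; 0ℚ; _/_; _-_; _*_)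
open import Relation.Binary.PropositionalEquality using (_≡_)
open import Relation.Nullary using (¬_)
open import Relation.Nullary.Decidable using (_⊎-dec_)

-- A graph on the vertex set Fin n, given by its list of edges.
-- Each edge {u,v} is stored as one ordered pair (u , v).
Edge : ℕ → Set
Edge n = Fin n × Fin n

Adj : {n : ℕ} → List (Edge n) → Fin n → Fin n → Set
Adj E u v = ((u , v) ∈ E) ⊎ ((v , u) ∈ E)

SameEdge : {n : ℕ} → Edge n → Edge n → Set
SameEdge e f = (e ≡ f) ⊎ (swap e ≡ f)

IsSimple : {n : ℕ} → List (Edge n) → Set
IsSimple E = All (λ e → ¬ (proj₁ e ≡ proj₂ e)) E × AllPairs (λ e f → ¬ SameEdge e f) E

data Walk {n : ℕ} (E : List (Edge n)) : Fin n → Fin n → Set where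
  here : ∀ {u} → Walk E u u
  step : ∀ {u v w} → Adj E u v → Walk E v w → Walk E u w

Connected : {n : ℕ} → List (Edge n) → Set
Connected {n} E = (u v : Fin n) → Walk E u v

Chain : {n : ℕ} → List (Edge n) → List (Fin n) → Set
Chain E [] = ⊤′
  where open import Data.Unit using () renaming (⊤ to ⊤′)
Chain E (u ∷ []) = ⊤′
  where open import Data.Unit using () renaming (⊤ to ⊤′)
Chain E (u ∷ v ∷ vs) = Adj E u v × Chain E (v ∷ vs)

HasCycle : {n : ℕ} → List (Edge n) → Set
HasCycle {n} E = Σ (Fin n) λ v → Σ (List (Fin n)) λ ws →
  (2 ≤ length ws) × Unique (v ∷ ws) × Chain E ((v ∷ ws) ++ [ v ])

Acyclic : {n : ℕ} → List (Edge n) → Set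
Acyclic E = ¬ HasCycle E

IsTree : (n : ℕ) → List (Edge n) → Set
IsTree n E = IsSimple E × Connected E × Acyclic E

degree : {n : ℕ} → List (Edge n) → Fin n → ℕ
degree E i = length (filter (λ e → (proj₁ e ≟ i) ⊎-dec (proj₂ e ≟ i)) E)

sumDegSq : (n : ℕ) → List (Edge n) → ℕ
sumDegSq n E = sum (map (λ i → degree E i ^ 2) (allFin n))

allVecs : (n m : ℕ) → List (Vec (Fin n) m)
allVecs n zero = []ᵥ ∷ []
allVecs n (suc m) = concatMap (λ i → map (i ∷ᵥ_) (allVecs n m)) (allFin n)

-- linear arrangements π : Fin n → Fin n bijective, represented by the
-- vector of positions (π(0),…,π(n-1)) with pairwise distinct entries
arrangements : (n : ℕ) → List (Vec (Fin n) n)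
arrangements n = filter (λ π → UDec.unique? _≟_ (toList π)) (allVecs n n)

D : {n : ℕ} → List (Edge n) → Vec (Fin n) n → ℕ
D E π = sum (map (λ e → ∣ toℕ (lookup π (proj₁ e)) - toℕ (lookup π (proj₂ e)) ∣) E)

mean : List ℕ → ℚ
mean [] = 0ℚ
mean (x ∷ xs) = (+ (sum (x ∷ xs))) / suc (length xs)

E-rla : {n : ℕ} → (Vec (Fin n) n → ℕ) → ℚ
E-rla {n} f = mean (map f (arrangements n))

V-rla : {n : ℕ} → (Vec (Fin n) n → ℕ) → ℚ
V-rla f = E-rla (λ π → f π ^ 2) - E-rla f * E-rla f

module Submission where

-- Write ℓ_π(e) for the length of edge e under the arrangement π, so that D(π)² = Σ_{e,f} ℓ_π(e) ℓ_π(f).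
-- Summed over all n! arrangements, ℓ_π(e) ℓ_π(f) only depends on the number k ∈ {2, 1, 0} of endpoints
-- shared by e and f: it is (n - 4 + k)! times the sum of the corresponding product of distances over
-- tuples of 4 - k distinct positions.  Inclusion-exclusion reduces these sums to
-- T = Σ_{a,b} |a - b|, Q = Σ_{a,b} (a - b)² and R = Σ_a (Σ_b |a - b|)², with 6T = 2n³ - 2n,
-- 6Q = n⁴ - n² and 60R = 7n⁵ - 15n³ + 8n.  For a tree with m = n - 1 edges the numbers N_k of ordered
-- edge pairs sharing k endpoints satisfy N₂ = m, N₁ + 2N₂ = n⟨k²⟩ and N₀ + N₁ + N₂ = m², which gives
-- E[D²]; likewise E[D] = m (n - 2)! T / n! = (n² - 1)/3, and the variance follows.

open import Defs
open import Data.Nat using (ℕ; zero; suc)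
open import Data.Nat.ListAction using (sum)
open import Data.Fin using (Fin; zero; suc; toℕ)
open import Data.Fin.Properties using (_≟_; suc-injective)
open import Data.List using (List; []; _∷_; _++_; [_]; map; concatMap; filter; allFin; length)
open import Data.List.Properties using (++-assoc; ++-identityʳ; length-++; map-tabulate; length-tabulate)
open import Data.List.Relation.Unary.All using (All; []; _∷_)
open import Data.List.Relation.Unary.All.Properties using (All¬⇒¬Any; ¬Any⇒All¬)
open import Data.List.Relation.Unary.Any using (here; there; any?)
open import Data.List.Relation.Unary.AllPairs using ([]; _∷_)
open import Data.List.Relation.Unary.Unique.Propositional using (Unique)
import Data.List.Relation.Unary.Unique.Propositional.Properties as Unique
import Data.List.Relation.Unary.Unique.DecPropositional as UniqueDec
open import Data.List.Membership.Propositional using (_∈_)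
open import Data.List.Relation.Binary.Permutation.Propositional using (_↭_; ↭-sym; ↭-trans; ↭-refl; ↭-prep; ↭-swap; ↭-reflexive; ↭⇒↭ₛ)
open import Data.List.Relation.Binary.Permutation.Propositional.Properties using (shift; ++⁺ˡ; ∈-resp-↭)
import Data.List.Relation.Binary.Permutation.Setoid.Properties as PermutationSetoid
open import Data.Vec as Vec using (Vec; lookup; toList; insertAt) renaming ([] to []ᵥ; _∷_ to _∷ᵥ_)
open import Data.Vec.Properties using (map-∘; map-insertAt; toList-map; length-toList)
open import Relation.Binary.PropositionalEquality hiding ([_])
open import Relation.Nullary using (Dec; yes; no; ¬_)
open import Relation.Unary using (Pred; Decidable)
open import Data.Product using (Σ; _×_; _,_; proj₁; proj₂)
open import Data.Sum using (inj₁; inj₂)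
open import Data.Empty using (⊥; ⊥-elim)
open import Function using (_∘_; _⇔_; mk⇔; Equivalence)

module Sums where

  open import Data.Nat using (_+_; _*_; _∸_; _≤_; z≤n; s≤s)
  open import Data.Nat.Properties hiding (_≟_; suc-injective)
  open import Data.Nat.Tactic.RingSolver using (solve-∀)

  ∑ : ∀ {a} {A : Set a} → List A → (A → ℕ) → ℕ
  ∑ xs f = sum (map f xs)

  syntax ∑ xs (λ x → e) = ∑[ x ∈ xs ] e

  𝟙 : ∀ {p} {P : Set p} → Dec P → ℕ
  𝟙 (yes _) = 1
  𝟙 (no _)  = 0

  𝟙-yes : ∀ {p} {P : Set p} (d : Dec P) → P → 𝟙 d ≡ 1
  𝟙-yes (yes _) _ = refl
  𝟙-yes (no ¬p) p = ⊥-elim (¬p p)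

  𝟙-no : ∀ {p} {P : Set p} (d : Dec P) → ¬ P → 𝟙 d ≡ 0
  𝟙-no (yes p) ¬p = ⊥-elim (¬p p)
  𝟙-no (no _)  _  = refl

  𝟙-≤1 : ∀ {p} {P : Set p} (d : Dec P) → 𝟙 d ≤ 1
  𝟙-≤1 (yes _) = s≤s z≤n
  𝟙-≤1 (no _)  = z≤n

  𝟙-cong : ∀ {p q} {P : Set p} {Q : Set q} (d : Dec P) (e : Dec Q) → P ⇔ Q → 𝟙 d ≡ 𝟙 e
  𝟙-cong (yes p) e       P⇔Q = sym (𝟙-yes e (Equivalence.to P⇔Q p))
  𝟙-cong (no ¬p) (yes q) P⇔Q = ⊥-elim (¬p (Equivalence.from P⇔Q q))
  𝟙-cong (no _)  (no _)  _   = refl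

  𝟙-≟-sym : ∀ {n} (i j : Fin n) → 𝟙 (i ≟ j) ≡ 𝟙 (j ≟ i)
  𝟙-≟-sym i j = 𝟙-cong (i ≟ j) (j ≟ i) (mk⇔ sym sym)

  module _ {a} {A : Set a} where

    ∑-cong : ∀ (xs : List A) {f g : A → ℕ} → (∀ x → f x ≡ g x) → ∑ xs f ≡ ∑ xs g
    ∑-cong []       eq = refl
    ∑-cong (x ∷ xs) eq = cong₂ _+_ (eq x) (∑-cong xs eq)

    ∑-cong-All : ∀ {p} {P : Pred A p} (xs : List A) {f g : A → ℕ} →
                 All P xs → (∀ x → P x → f x ≡ g x) → ∑ xs f ≡ ∑ xs g
    ∑-cong-All []       []         eq = refl
    ∑-cong-All (x ∷ xs) (px ∷ pxs) eq = cong₂ _+_ (eq x px) (∑-cong-All xs pxs eq)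

    ∑-zero : ∀ (xs : List A) {f : A → ℕ} → (∀ x → f x ≡ 0) → ∑ xs f ≡ 0
    ∑-zero []       eq = refl
    ∑-zero (x ∷ xs) eq rewrite eq x = ∑-zero xs eq

    ∑-const : ∀ (xs : List A) c → ∑[ _ ∈ xs ] c ≡ length xs * c
    ∑-const []       c = refl
    ∑-const (x ∷ xs) c = cong (c +_) (∑-const xs c)

    ∑-+ : ∀ (xs : List A) (f g : A → ℕ) → ∑[ x ∈ xs ] (f x + g x) ≡ ∑ xs f + ∑ xs g
    ∑-+ []       f g = refl
    ∑-+ (x ∷ xs) f g rewrite ∑-+ xs f g = interchange (f x) (g x) (∑ xs f) (∑ xs g)
      where
      interchange : ∀ a b c d → a + b + (c + d) ≡ a + c + (b + d)
      interchange = solve-∀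

    ∑-*ˡ : ∀ (xs : List A) c (f : A → ℕ) → ∑[ x ∈ xs ] (c * f x) ≡ c * ∑ xs f
    ∑-*ˡ []       c f = sym (*-zeroʳ c)
    ∑-*ˡ (x ∷ xs) c f rewrite ∑-*ˡ xs c f = sym (*-distribˡ-+ c (f x) (∑ xs f))

    ∑-*ʳ : ∀ (xs : List A) c (f : A → ℕ) → ∑[ x ∈ xs ] (f x * c) ≡ ∑ xs f * c
    ∑-*ʳ xs c f = trans (∑-cong xs (λ x → *-comm (f x) c)) (trans (∑-*ˡ xs c f) (*-comm c _))

    ∑-++ : ∀ (xs ys : List A) (f : A → ℕ) → ∑ (xs ++ ys) f ≡ ∑ xs f + ∑ ys f
    ∑-++ []       ys f = refl
    ∑-++ (x ∷ xs) ys f rewrite ∑-++ xs ys f = sym (+-assoc (f x) _ _)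

    ∑-filter : ∀ {p} {P : Pred A p} (P? : Decidable P) (xs : List A) (f : A → ℕ) →
               ∑ (filter P? xs) f ≡ ∑[ x ∈ xs ] (𝟙 (P? x) * f x)
    ∑-filter P? []       f = refl
    ∑-filter P? (x ∷ xs) f with P? x
    ... | yes _ = cong₂ _+_ (sym (+-identityʳ (f x))) (∑-filter P? xs f)
    ... | no _  = ∑-filter P? xs f

    length-filter : ∀ {p} {P : Pred A p} (P? : Decidable P) (xs : List A) →
                    length (filter P? xs) ≡ ∑[ x ∈ xs ] 𝟙 (P? x)
    length-filter P? xs = begin
      length (filter P? xs)            ≡⟨ sym (*-identityʳ _) ⟩
      length (filter P? xs) * 1        ≡⟨ sym (∑-const (filter P? xs) 1) ⟩
      ∑ (filter P? xs) (λ _ → 1)       ≡⟨ ∑-filter P? xs (λ _ → 1) ⟩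
      ∑[ x ∈ xs ] (𝟙 (P? x) * 1)       ≡⟨ ∑-cong xs (λ x → *-identityʳ _) ⟩
      ∑[ x ∈ xs ] 𝟙 (P? x)             ∎
      where open ≡-Reasoning

    ∑-mono-≤ : ∀ (xs : List A) {f g : A → ℕ} → (∀ x → f x ≤ g x) → ∑ xs f ≤ ∑ xs g
    ∑-mono-≤ []       le = z≤n
    ∑-mono-≤ (x ∷ xs) le = +-mono-≤ (le x) (∑-mono-≤ xs le)

  module _ {a b} {A : Set a} {B : Set b} where

    ∑-map : ∀ (g : A → B) (xs : List A) (f : B → ℕ) → ∑ (map g xs) f ≡ ∑[ x ∈ xs ] f (g x)
    ∑-map g []       f = refl
    ∑-map g (x ∷ xs) f = cong (f (g x) +_) (∑-map g xs f)

    ∑-concatMap : ∀ (h : A → List B) (xs : List A) (f : B → ℕ) →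
                  ∑ (concatMap h xs) f ≡ ∑[ x ∈ xs ] ∑ (h x) f
    ∑-concatMap h []       f = refl
    ∑-concatMap h (x ∷ xs) f = trans (∑-++ (h x) (concatMap h xs) f) (cong (∑ (h x) f +_) (∑-concatMap h xs f))

    ∑-swap : ∀ (xs : List A) (ys : List B) (f : A → B → ℕ) →
             ∑[ x ∈ xs ] ∑[ y ∈ ys ] f x y ≡ ∑[ y ∈ ys ] ∑[ x ∈ xs ] f x y
    ∑-swap []       ys f = sym (∑-zero ys (λ _ → refl))
    ∑-swap (x ∷ xs) ys f = trans (cong (∑ ys (f x) +_) (∑-swap xs ys f))
                                 (sym (∑-+ ys (f x) (λ y → ∑[ x′ ∈ xs ] f x′ y)))

  ∑-allFin-suc : ∀ n (f : Fin (suc n) → ℕ) → ∑ (allFin (suc n)) f ≡ f zero + ∑[ i ∈ allFin n ] f (suc i)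
  ∑-allFin-suc n f = trans (cong (λ is → f zero + ∑ is f) (sym (map-tabulate (λ i → i) suc)))
                           (cong (f zero +_) (∑-map suc (allFin n) f))

  ∑-allFin-const : ∀ n c → ∑[ _ ∈ allFin n ] c ≡ n * c
  ∑-allFin-const n c = trans (∑-const (allFin n) c) (cong (_* c) (length-tabulate {n = n} (λ (i : Fin n) → i)))

  module _ {a} {A : Set a} where

    Unique-resp-↭ : ∀ {xs ys : List A} → xs ↭ ys → Unique xs → Unique ys
    Unique-resp-↭ p = PermutationSetoid.Unique-resp-↭ (setoid A) (↭⇒↭ₛ p)

    Unique-shift : ∀ (xs : List A) {x : A} ys → Unique (xs ++ x ∷ ys) ⇔ Unique (x ∷ xs ++ ys)
    Unique-shift xs {x} ys = mk⇔ (Unique-resp-↭ (shift x xs ys)) (Unique-resp-↭ (↭-sym (shift x xs ys)))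

    Unique-∷⇔ : ∀ {x : A} {xs} → Unique (x ∷ xs) ⇔ (¬ x ∈ xs × Unique xs)
    Unique-∷⇔ = mk⇔ (λ { (x∉ ∷ u) → All¬⇒¬Any x∉ , u }) (λ (x∉ , u) → ¬Any⇒All¬ _ x∉ ∷ u)

  module _ {n : ℕ} where

    unique? : (xs : List (Fin n)) → Dec (Unique xs)
    unique? = UniqueDec.unique? _≟_

    _∈?_ : (i : Fin n) (xs : List (Fin n)) → Dec (i ∈ xs)
    i ∈? xs = any? (i ≟_) xs

  ∑-point : ∀ {n} (z : Fin n) (h : Fin n → ℕ) → ∑[ i ∈ allFin n ] (𝟙 (i ≟ z) * h i) ≡ h z
  ∑-point {suc n} zero    h = begin
    ∑[ i ∈ allFin (suc n) ] (𝟙 (i ≟ zero) * h i) ≡⟨ ∑-allFin-suc n (λ i → 𝟙 (i ≟ zero) * h i) ⟩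
    (h zero + 0) + ∑[ i ∈ allFin n ] 0            ≡⟨ cong₂ _+_ (+-identityʳ _) (∑-zero (allFin n) (λ _ → refl)) ⟩
    h zero + 0                                    ≡⟨ +-identityʳ _ ⟩
    h zero                                        ∎
    where open ≡-Reasoning
  ∑-point {suc n} (suc z) h = begin
    ∑[ i ∈ allFin (suc n) ] (𝟙 (i ≟ suc z) * h i)       ≡⟨ ∑-allFin-suc n (λ i → 𝟙 (i ≟ suc z) * h i) ⟩
    ∑[ i ∈ allFin n ] (𝟙 (suc i ≟ suc z) * h (suc i))   ≡⟨ ∑-cong (allFin n) (λ i →
                                                            cong (_* h (suc i)) (𝟙-cong (suc i ≟ suc z) (i ≟ z) (mk⇔ suc-injective (cong suc)))) ⟩
    ∑[ i ∈ allFin n ] (𝟙 (i ≟ z) * h (suc i))           ≡⟨ ∑-point z (h ∘ suc) ⟩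
    h (suc z)                                           ∎
    where open ≡-Reasoning

  module _ {n : ℕ} where

    𝟙-∈-∷ : ∀ {z} {zs : List (Fin n)} → ¬ z ∈ zs → ∀ i → 𝟙 (i ∈? (z ∷ zs)) ≡ 𝟙 (i ≟ z) + 𝟙 (i ∈? zs)
    𝟙-∈-∷ {z} {zs} z∉ i with i ∈? (z ∷ zs) | i ≟ z | i ∈? zs
    ... | _            | yes refl | yes i∈ = ⊥-elim (z∉ i∈)
    ... | yes _        | yes _    | no _   = refl
    ... | yes _        | no _     | yes _  = refl
    ... | yes (here e) | no i≢z   | no _   = ⊥-elim (i≢z e)
    ... | yes (there m)| no _     | no i∉  = ⊥-elim (i∉ m)
    ... | no i∉        | yes e    | _      = ⊥-elim (i∉ (here e))
    ... | no i∉        | no _     | yes m  = ⊥-elim (i∉ (there m))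
    ... | no _         | no _     | no _   = refl

    ∑-∈ : ∀ (zs : List (Fin n)) → Unique zs → (h : Fin n → ℕ) →
          ∑[ i ∈ allFin n ] (𝟙 (i ∈? zs) * h i) ≡ ∑ zs h
    ∑-∈ []       _        h = ∑-zero (allFin n) (λ _ → refl)
    ∑-∈ (z ∷ zs) (z∉ ∷ u) h = begin
      ∑[ i ∈ allFin n ] (𝟙 (i ∈? (z ∷ zs)) * h i)
        ≡⟨ ∑-cong (allFin n) (λ i → trans (cong (_* h i) (𝟙-∈-∷ (All¬⇒¬Any z∉) i)) (*-distribʳ-+ (h i) (𝟙 (i ≟ z)) _)) ⟩
      ∑[ i ∈ allFin n ] (𝟙 (i ≟ z) * h i + 𝟙 (i ∈? zs) * h i)
        ≡⟨ ∑-+ (allFin n) _ _ ⟩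
      ∑[ i ∈ allFin n ] (𝟙 (i ≟ z) * h i) + ∑[ i ∈ allFin n ] (𝟙 (i ∈? zs) * h i)
        ≡⟨ cong₂ _+_ (∑-point z h) (∑-∈ zs u h) ⟩
      h z + ∑ zs h ∎
      where open ≡-Reasoning

    length-≤ : ∀ (zs : List (Fin n)) → Unique zs → length zs ≤ n
    length-≤ zs u = begin
      length zs                               ≡⟨ sym (trans (∑-const zs 1) (*-identityʳ _)) ⟩
      ∑[ _ ∈ zs ] 1                           ≡⟨ sym (∑-∈ zs u (λ _ → 1)) ⟩
      ∑[ i ∈ allFin n ] (𝟙 (i ∈? zs) * 1)     ≤⟨ ∑-mono-≤ (allFin n) (λ i → *-monoˡ-≤ 1 (𝟙-≤1 (i ∈? zs))) ⟩
      ∑[ _ ∈ allFin n ] 1                     ≡⟨ trans (∑-allFin-const n 1) (*-identityʳ n) ⟩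
      n                                       ∎
      where open ≤-Reasoning

    -- A fresh position i keeps zs repetition-free exactly when i ∉ zs.
    ∑-fresh-∷ : ∀ (zs : List (Fin n)) (h : Fin n → ℕ) →
      ∑[ i ∈ allFin n ] (𝟙 (unique? (i ∷ zs)) * h i) + 𝟙 (unique? zs) * ∑ zs h ≡ 𝟙 (unique? zs) * ∑ (allFin n) h
    ∑-fresh-∷ zs h = fresh (unique? zs)
      where
      open ≡-Reasoning
      fresh : (u? : Dec (Unique zs)) →
        ∑[ i ∈ allFin n ] (𝟙 (unique? (i ∷ zs)) * h i) + 𝟙 u? * ∑ zs h ≡ 𝟙 u? * ∑ (allFin n) h
      fresh (no ¬u) = trans (+-identityʳ _) (∑-zero (allFin n) (λ i →
        cong (_* h i) (𝟙-no (unique? (i ∷ zs)) (¬u ∘ proj₂ ∘ Equivalence.to Unique-∷⇔))))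
      fresh (yes u) = begin
        ∑[ i ∈ allFin n ] (𝟙 (unique? (i ∷ zs)) * h i) + 1 * ∑ zs h
          ≡⟨ cong (∑[ i ∈ allFin n ] (𝟙 (unique? (i ∷ zs)) * h i) +_) (trans (*-identityˡ _) (sym (∑-∈ zs u h))) ⟩
        ∑[ i ∈ allFin n ] (𝟙 (unique? (i ∷ zs)) * h i) + ∑[ i ∈ allFin n ] (𝟙 (i ∈? zs) * h i)
          ≡⟨ sym (∑-+ (allFin n) _ _) ⟩
        ∑[ i ∈ allFin n ] (𝟙 (unique? (i ∷ zs)) * h i + 𝟙 (i ∈? zs) * h i)
          ≡⟨ ∑-cong (allFin n) (λ i → trans (sym (*-distribʳ-+ (h i) (𝟙 (unique? (i ∷ zs))) _))
                                            (trans (cong (_* h i) (complementary i)) (*-identityˡ (h i)))) ⟩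
        ∑ (allFin n) h
          ≡⟨ sym (*-identityˡ _) ⟩
        1 * ∑ (allFin n) h ∎
        where
        complementary : ∀ i → 𝟙 (unique? (i ∷ zs)) + 𝟙 (i ∈? zs) ≡ 1
        complementary i with unique? (i ∷ zs) | i ∈? zs
        ... | yes u′ | yes i∈ = ⊥-elim (proj₁ (Equivalence.to Unique-∷⇔ u′) i∈)
        ... | yes _  | no _   = refl
        ... | no _   | yes _  = refl
        ... | no ¬u′ | no i∉  = ⊥-elim (¬u′ (Equivalence.from Unique-∷⇔ (i∉ , u)))

    ∑-fresh : ∀ (xs ys : List (Fin n)) (h : Fin n → ℕ) →
      ∑[ i ∈ allFin n ] (𝟙 (unique? (xs ++ i ∷ ys)) * h i) + 𝟙 (unique? (xs ++ ys)) * ∑ (xs ++ ys) h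
        ≡ 𝟙 (unique? (xs ++ ys)) * ∑ (allFin n) h
    ∑-fresh xs ys h = trans (cong (_+ 𝟙 (unique? (xs ++ ys)) * ∑ (xs ++ ys) h) (∑-cong (allFin n) (λ i →
        cong (_* h i) (𝟙-cong (unique? (xs ++ i ∷ ys)) (unique? (i ∷ xs ++ ys)) (Unique-shift xs ys)))))
      (∑-fresh-∷ (xs ++ ys) h)

    count-fresh : ∀ (xs ys : List (Fin n)) →
      ∑[ i ∈ allFin n ] 𝟙 (unique? (xs ++ i ∷ ys)) ≡ (n ∸ length (xs ++ ys)) * 𝟙 (unique? (xs ++ ys))
    count-fresh xs ys = begin
      F                   ≡⟨ sym (m+n∸n≡m F (u * L)) ⟩
      F + u * L ∸ u * L   ≡⟨ cong (_∸ u * L) fresh ⟩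
      u * n ∸ u * L       ≡⟨ sym (*-distribˡ-∸ u n L) ⟩
      u * (n ∸ L)         ≡⟨ *-comm u (n ∸ L) ⟩
      (n ∸ L) * u         ∎
      where
      open ≡-Reasoning
      F = ∑[ i ∈ allFin n ] 𝟙 (unique? (xs ++ i ∷ ys))
      u = 𝟙 (unique? (xs ++ ys))
      L = length (xs ++ ys)
      fresh : F + u * L ≡ u * n
      fresh = begin
        F + u * L
          ≡⟨ cong₂ (λ a b → a + u * b) (∑-cong (allFin n) (λ i → sym (*-identityʳ _)))
                                       (sym (trans (∑-const (xs ++ ys) 1) (*-identityʳ _))) ⟩
        ∑[ i ∈ allFin n ] (𝟙 (unique? (xs ++ i ∷ ys)) * 1) + u * ∑[ _ ∈ xs ++ ys ] 1
          ≡⟨ ∑-fresh xs ys (λ _ → 1) ⟩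
        u * ∑[ _ ∈ allFin n ] 1
          ≡⟨ cong (u *_) (trans (∑-allFin-const n 1) (*-identityʳ n)) ⟩
        u * n ∎


module InjectiveSums where

  open import Data.Nat using (_+_; _*_; _∸_; _≤_; _!)
  open import Data.Nat.Properties hiding (_≟_; suc-injective)
  open Sums

  toList-insertAt-↭ : ∀ {a} {A : Set a} {k} (xs : Vec A k) j x → toList (insertAt xs j x) ↭ x ∷ toList xs
  toList-insertAt-↭ xs         zero    x = ↭-refl
  toList-insertAt-↭ (y ∷ᵥ xs) (suc j) x = ↭-trans (↭-prep y (toList-insertAt-↭ xs j x)) (↭-swap y x ↭-refl)

  data ZeroView {m : ℕ} : ∀ {k} → Vec (Fin (suc m)) k → Set where
    avoids-zero : ∀ {k} (ps : Vec (Fin m) k) → Unique (toList ps) → ZeroView (Vec.map suc ps)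
    hits-zero   : ∀ {k} (ps : Vec (Fin m) k) j → Unique (toList ps) → ZeroView (insertAt (Vec.map suc ps) j zero)

  Unique-toList-map⁻ : ∀ {m k} {f : Fin m → Fin (suc m)} (ps : Vec (Fin m) k) →
                       Unique (toList (Vec.map f ps)) → Unique (toList ps)
  Unique-toList-map⁻ ps u = Unique.map⁻ (subst Unique (toList-map _ ps) u)

  zeroView : ∀ {m k} (ps : Vec (Fin (suc m)) k) → Unique (toList ps) → ZeroView ps
  zeroView []ᵥ                 u        = avoids-zero []ᵥ []
  zeroView (p ∷ᵥ ps)           (p∉ ∷ u) with zeroView ps u
  zeroView (zero ∷ᵥ _)         (p∉ ∷ u) | avoids-zero ps′ u′ = hits-zero ps′ zero u′
  zeroView (zero ∷ᵥ _)         (p∉ ∷ u) | hits-zero ps′ j u′ =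
    ⊥-elim (All¬⇒¬Any p∉ (∈-resp-↭ (↭-sym (toList-insertAt-↭ (Vec.map suc ps′) j zero)) (here refl)))
  zeroView (suc p ∷ᵥ _)        u        | avoids-zero ps′ u′ = avoids-zero (p ∷ᵥ ps′) (Unique-toList-map⁻ (p ∷ᵥ ps′) u)
  zeroView (suc p ∷ᵥ _)        u        | hits-zero ps′ j u′ =
    hits-zero (p ∷ᵥ ps′) (suc j) (Unique-toList-map⁻ (p ∷ᵥ ps′)
      (proj₂ (Equivalence.to Unique-∷⇔ (Unique-resp-↭ (toList-insertAt-↭ (Vec.map suc (p ∷ᵥ ps′)) (suc j) zero) u))))

  !-step : ∀ {m k} → k ≤ m → ∀ v → (m ∸ k) ! * ((suc m ∸ k) * v) ≡ (suc m ∸ k) ! * v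
  !-step {m} {k} k≤m v rewrite +-∸-assoc 1 k≤m = begin
    (m ∸ k) ! * (suc (m ∸ k) * v)   ≡⟨ sym (*-assoc ((m ∸ k) !) (suc (m ∸ k)) v) ⟩
    (m ∸ k) ! * suc (m ∸ k) * v     ≡⟨ cong (_* v) (*-comm ((m ∸ k) !) (suc (m ∸ k))) ⟩
    suc (m ∸ k) ! * v               ∎
    where open ≡-Reasoning

  length-snoc : ∀ {a} {A : Set a} (xs : List A) x m → length (xs ++ [ x ]) + m ≡ length xs + suc m
  length-snoc xs x m = trans (cong (_+ m) (length-++ xs)) (+-assoc (length xs) 1 m)

  module _ {n : ℕ} where

    -- The arrangements of Defs are the tuples counted by injSum [] n.
    injSum : List (Fin n) → (m : ℕ) → (Vec (Fin n) m → ℕ) → ℕ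
    injSum S m F = ∑[ w ∈ allVecs n m ] (𝟙 (unique? (S ++ toList w)) * F w)

    injSum-cong : ∀ S m {F G : Vec (Fin n) m → ℕ} → (∀ w → F w ≡ G w) → injSum S m F ≡ injSum S m G
    injSum-cong S m eq = ∑-cong (allVecs n m) (λ w → cong (𝟙 (unique? (S ++ toList w)) *_) (eq w))

    injSum-zero : ∀ S (F : Vec (Fin n) 0 → ℕ) → injSum S 0 F ≡ 𝟙 (unique? S) * F []ᵥ
    injSum-zero S F = trans (+-identityʳ _) (cong (λ L → 𝟙 (unique? L) * F []ᵥ) (++-identityʳ S))

    ∑-allVecs-suc : ∀ k (F : Vec (Fin n) (suc k) → ℕ) →
      ∑ (allVecs n (suc k)) F ≡ ∑[ i ∈ allFin n ] ∑[ w ∈ allVecs n k ] F (i ∷ᵥ w)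
    ∑-allVecs-suc k F = trans (∑-concatMap (λ i → map (i ∷ᵥ_) (allVecs n k)) (allFin n) F)
                              (∑-cong (allFin n) λ i → ∑-map (i ∷ᵥ_) (allVecs n k) F)

    ∑-allVecs-insertAt : ∀ k (j : Fin (suc k)) (F : Vec (Fin n) (suc k) → ℕ) →
      ∑ (allVecs n (suc k)) F ≡ ∑[ i ∈ allFin n ] ∑[ w ∈ allVecs n k ] F (insertAt w j i)
    ∑-allVecs-insertAt k       zero    F = ∑-allVecs-suc k F
    ∑-allVecs-insertAt (suc k) (suc j) F = begin
      ∑ (allVecs n (suc (suc k))) F
        ≡⟨ ∑-allVecs-suc (suc k) F ⟩
      ∑[ b ∈ allFin n ] ∑[ w ∈ allVecs n (suc k) ] F (b ∷ᵥ w)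
        ≡⟨ ∑-cong (allFin n) (λ b → ∑-allVecs-insertAt k j (λ w → F (b ∷ᵥ w))) ⟩
      ∑[ b ∈ allFin n ] ∑[ i ∈ allFin n ] ∑[ w ∈ allVecs n k ] F (b ∷ᵥ insertAt w j i)
        ≡⟨ ∑-swap (allFin n) (allFin n) _ ⟩
      ∑[ i ∈ allFin n ] ∑[ b ∈ allFin n ] ∑[ w ∈ allVecs n k ] F (b ∷ᵥ insertAt w j i)
        ≡⟨ ∑-cong (allFin n) (λ i → sym (∑-allVecs-suc k (λ w → F (insertAt w (suc j) i)))) ⟩
      ∑[ i ∈ allFin n ] ∑[ w ∈ allVecs n (suc k) ] F (insertAt w (suc j) i) ∎
      where open ≡-Reasoning

    injSum-suc : ∀ S m (F : Vec (Fin n) (suc m) → ℕ) →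
      injSum S (suc m) F ≡ ∑[ i ∈ allFin n ] injSum (S ++ [ i ]) m (λ w → F (i ∷ᵥ w))
    injSum-suc S m F = trans (∑-allVecs-suc m _) (∑-cong (allFin n) λ i → ∑-cong (allVecs n m) λ w →
      cong (λ L → 𝟙 (unique? L) * F (i ∷ᵥ w)) (sym (++-assoc S [ i ] (toList w))))

    injSum-insertAt : ∀ k (j : Fin (suc k)) S (G : Vec (Fin n) (suc k) → ℕ) →
      ∑[ i ∈ allFin n ] injSum (S ++ [ i ]) k (λ w → G (insertAt w j i)) ≡ injSum S (suc k) G
    injSum-insertAt k j S G = sym (trans (∑-allVecs-insertAt k j _) (∑-cong (allFin n) λ i → ∑-cong (allVecs n k) λ w →
      cong (_* G (insertAt w j i)) (𝟙-cong (unique? (S ++ toList (insertAt w j i))) (unique? ((S ++ [ i ]) ++ toList w))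
        (mk⇔ (Unique-resp-↭ (perm i w)) (Unique-resp-↭ (↭-sym (perm i w)))))))
      where
      perm : ∀ i w → S ++ toList (insertAt w j i) ↭ (S ++ [ i ]) ++ toList w
      perm i w = ↭-trans (++⁺ˡ S (toList-insertAt-↭ w j i)) (↭-reflexive (sym (++-assoc S [ i ] (toList w))))

    injSum-count : ∀ k S (G : Vec (Fin n) k → ℕ) →
      ∑[ i ∈ allFin n ] injSum (S ++ [ i ]) k G ≡ (n ∸ (length S + k)) * injSum S k G
    injSum-count k S G = begin
      ∑[ i ∈ allFin n ] injSum (S ++ [ i ]) k G
        ≡⟨ ∑-swap (allFin n) (allVecs n k) _ ⟩
      ∑[ w ∈ allVecs n k ] ∑[ i ∈ allFin n ] (𝟙 (unique? ((S ++ [ i ]) ++ toList w)) * G w)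
        ≡⟨ ∑-cong (allVecs n k) (λ w → ∑-*ʳ (allFin n) (G w) _) ⟩
      ∑[ w ∈ allVecs n k ] (∑[ i ∈ allFin n ] 𝟙 (unique? ((S ++ [ i ]) ++ toList w)) * G w)
        ≡⟨ ∑-cong (allVecs n k) (λ w → cong (_* G w) (trans
             (∑-cong (allFin n) λ i → cong (λ L → 𝟙 (unique? L)) (++-assoc S [ i ] (toList w)))
             (count-fresh S (toList w)))) ⟩
      ∑[ w ∈ allVecs n k ] ((n ∸ length (S ++ toList w)) * 𝟙 (unique? (S ++ toList w)) * G w)
        ≡⟨ ∑-cong (allVecs n k) (λ w → trans (cong (λ l → (n ∸ l) * 𝟙 (unique? (S ++ toList w)) * G w)
               (trans (length-++ S) (cong (length S +_) (length-toList w))))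
               (*-assoc (n ∸ (length S + k)) _ _)) ⟩
      ∑[ w ∈ allVecs n k ] ((n ∸ (length S + k)) * (𝟙 (unique? (S ++ toList w)) * G w))
        ≡⟨ ∑-*ˡ (allVecs n k) (n ∸ (length S + k)) _ ⟩
      (n ∸ (length S + k)) * injSum S k G ∎
      where open ≡-Reasoning

    restrict-avoiding : ∀ m {k} S (ps : Vec (Fin m) k) → Unique (toList ps) → length S + suc m ≡ n →
      (G : Vec (Fin n) k → ℕ) →
      (∀ i → injSum (S ++ [ i ]) m (λ w → G (Vec.map (lookup w) ps)) ≡ (m ∸ k) ! * injSum (S ++ [ i ]) k G) →
      injSum S (suc m) (λ w → G (Vec.map (lookup w) (Vec.map suc ps))) ≡ (suc m ∸ k) ! * injSum S k G
    restrict-avoiding m {k} S ps u len G IH = begin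
      injSum S (suc m) (λ w → G (Vec.map (lookup w) (Vec.map suc ps)))
        ≡⟨ injSum-suc S m _ ⟩
      ∑[ i ∈ allFin n ] injSum (S ++ [ i ]) m (λ w → G (Vec.map (lookup (i ∷ᵥ w)) (Vec.map suc ps)))
        ≡⟨ ∑-cong (allFin n) (λ i → trans (injSum-cong (S ++ [ i ]) m (λ w → cong G (sym (map-∘ _ suc ps)))) (IH i)) ⟩
      ∑[ i ∈ allFin n ] ((m ∸ k) ! * injSum (S ++ [ i ]) k G)
        ≡⟨ trans (∑-*ˡ (allFin n) ((m ∸ k) !) _) (cong ((m ∸ k) ! *_) (injSum-count k S G)) ⟩
      (m ∸ k) ! * ((n ∸ (length S + k)) * injSum S k G)
        ≡⟨ cong (λ l → (m ∸ k) ! * (l * injSum S k G)) remaining ⟩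
      (m ∸ k) ! * ((suc m ∸ k) * injSum S k G)
        ≡⟨ !-step (subst (_≤ m) (length-toList ps) (length-≤ (toList ps) u)) (injSum S k G) ⟩
      (suc m ∸ k) ! * injSum S k G ∎
      where
      open ≡-Reasoning
      remaining : n ∸ (length S + k) ≡ suc m ∸ k
      remaining = trans (cong (_∸ (length S + k)) (sym len)) ([m+n]∸[m+o]≡n∸o (length S) (suc m) k)

    restrict-hitting : ∀ m {k} S (ps : Vec (Fin m) k) j (G : Vec (Fin n) (suc k) → ℕ) →
      (∀ i → injSum (S ++ [ i ]) m (λ w → G (insertAt (Vec.map (lookup w) ps) j i))
             ≡ (m ∸ k) ! * injSum (S ++ [ i ]) k (λ w → G (insertAt w j i))) →
      injSum S (suc m) (λ w → G (Vec.map (lookup w) (insertAt (Vec.map suc ps) j zero))) ≡ (m ∸ k) ! * injSum S (suc k) G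
    restrict-hitting m {k} S ps j G IH = begin
      injSum S (suc m) (λ w → G (Vec.map (lookup w) (insertAt (Vec.map suc ps) j zero)))
        ≡⟨ injSum-suc S m _ ⟩
      ∑[ i ∈ allFin n ] injSum (S ++ [ i ]) m (λ w → G (Vec.map (lookup (i ∷ᵥ w)) (insertAt (Vec.map suc ps) j zero)))
        ≡⟨ ∑-cong (allFin n) (λ i → trans (injSum-cong (S ++ [ i ]) m (λ w → cong G (lookup-insert i w))) (IH i)) ⟩
      ∑[ i ∈ allFin n ] ((m ∸ k) ! * injSum (S ++ [ i ]) k (λ w → G (insertAt w j i)))
        ≡⟨ ∑-*ˡ (allFin n) ((m ∸ k) !) _ ⟩
      (m ∸ k) ! * ∑[ i ∈ allFin n ] injSum (S ++ [ i ]) k (λ w → G (insertAt w j i))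
        ≡⟨ cong ((m ∸ k) ! *_) (injSum-insertAt k j S G) ⟩
      (m ∸ k) ! * injSum S (suc k) G ∎
      where
      open ≡-Reasoning
      lookup-insert : ∀ i w → Vec.map (lookup (i ∷ᵥ w)) (insertAt (Vec.map suc ps) j zero)
                              ≡ insertAt (Vec.map (lookup w) ps) j i
      lookup-insert i w = trans (map-insertAt (lookup (i ∷ᵥ w)) zero (Vec.map suc ps) j)
                                (cong (λ v → insertAt v j i) (sym (map-∘ (lookup (i ∷ᵥ w)) suc ps)))

    -- Summing a function of k fixed (distinct) coordinates of the tuple: the other m ∸ k
    -- coordinates run over the (m ∸ k)! arrangements of the remaining values.
    injSum-restrict : ∀ m {k} S (ps : Vec (Fin m) k) → Unique (toList ps) → length S + m ≡ n →
      (G : Vec (Fin n) k → ℕ) → injSum S m (λ w → G (Vec.map (lookup w) ps)) ≡ (m ∸ k) ! * injSum S k G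
    injSum-restrict zero    S []ᵥ _ _   G = sym (+-identityʳ _)
    injSum-restrict (suc m) S ps  u len G with zeroView ps u
    ... | avoids-zero ps′ u′ = restrict-avoiding m S ps′ u′ len G (λ i →
      injSum-restrict m (S ++ [ i ]) ps′ u′ (trans (length-snoc S i m) len) G)
    ... | hits-zero ps′ j u′ = restrict-hitting m S ps′ j G (λ i →
      injSum-restrict m (S ++ [ i ]) ps′ u′ (trans (length-snoc S i m) len) (λ w → G (insertAt w j i)))


module Distances where

  open import Data.Nat using (_+_; _*_; ∣_-_∣)
  open import Data.Nat.Properties hiding (_≟_; suc-injective)
  open Sums

  module _ {n : ℕ} where

    dist : Fin n → Fin n → ℕ
    dist a b = ∣ toℕ a - toℕ b ∣

    rowDist : Fin n → ℕ
    rowDist a = ∑ (allFin n) (dist a)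

  totalDist totalDistSq totalRowDistSq : ℕ → ℕ
  totalDist n      = ∑[ a ∈ allFin n ] rowDist a
  totalDistSq n    = ∑[ a ∈ allFin n ] ∑[ b ∈ allFin n ] (dist a b * dist a b)
  totalRowDistSq n = ∑[ a ∈ allFin n ] (rowDist a * rowDist a)

  module _ {n : ℕ} where

    𝟙≢₂ : Fin n → Fin n → ℕ
    𝟙≢₂ a b = 𝟙 (unique? (a ∷ b ∷ []))

    𝟙≢₃ : Fin n → Fin n → Fin n → ℕ
    𝟙≢₃ a b c = 𝟙 (unique? (a ∷ b ∷ c ∷ []))

    𝟙≢₄ : Fin n → Fin n → Fin n → Fin n → ℕ
    𝟙≢₄ a b c e = 𝟙 (unique? (a ∷ b ∷ c ∷ e ∷ []))

    ∑₂ : (Fin n → Fin n → ℕ) → ℕ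
    ∑₂ f = ∑[ a ∈ allFin n ] ∑[ b ∈ allFin n ] f a b

    ∑₃ : (Fin n → Fin n → Fin n → ℕ) → ℕ
    ∑₃ f = ∑[ a ∈ allFin n ] ∑₂ (f a)

    ∑₂-cong : ∀ {f g : Fin n → Fin n → ℕ} → (∀ a b → f a b ≡ g a b) → ∑₂ f ≡ ∑₂ g
    ∑₂-cong eq = ∑-cong (allFin n) (λ a → ∑-cong (allFin n) (eq a))

    ∑₃-cong : ∀ {f g : Fin n → Fin n → Fin n → ℕ} → (∀ a b c → f a b c ≡ g a b c) → ∑₃ f ≡ ∑₃ g
    ∑₃-cong eq = ∑-cong (allFin n) (λ a → ∑₂-cong (eq a))

    ∑₂-+ : ∀ (f g : Fin n → Fin n → ℕ) → ∑₂ (λ a b → f a b + g a b) ≡ ∑₂ f + ∑₂ g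
    ∑₂-+ f g = trans (∑-cong (allFin n) (λ a → ∑-+ (allFin n) (f a) (g a))) (∑-+ (allFin n) _ _)

    ∑₃-+ : ∀ (f g : Fin n → Fin n → Fin n → ℕ) → ∑₃ (λ a b c → f a b c + g a b c) ≡ ∑₃ f + ∑₃ g
    ∑₃-+ f g = trans (∑-cong (allFin n) (λ a → ∑₂-+ (f a) (g a))) (∑-+ (allFin n) _ _)

    ∑₂-swap : ∀ (f : Fin n → Fin n → ℕ) → ∑₂ f ≡ ∑₂ (λ a b → f b a)
    ∑₂-swap f = ∑-swap (allFin n) (allFin n) f

    𝟙≢₂-swap : (a b : Fin n) → 𝟙≢₂ a b ≡ 𝟙≢₂ b a
    𝟙≢₂-swap a b = 𝟙-cong (unique? (a ∷ b ∷ [])) (unique? (b ∷ a ∷ []))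
      (mk⇔ (Unique-resp-↭ (↭-swap a b ↭-refl)) (Unique-resp-↭ (↭-swap b a ↭-refl)))

    𝟙≢₃-swap : (a b c : Fin n) → 𝟙≢₃ a b c ≡ 𝟙≢₃ b a c
    𝟙≢₃-swap a b c = 𝟙-cong (unique? (a ∷ b ∷ c ∷ [])) (unique? (b ∷ a ∷ c ∷ []))
      (mk⇔ (Unique-resp-↭ (↭-swap a b ↭-refl)) (Unique-resp-↭ (↭-swap b a ↭-refl)))

    dist-self : (a : Fin n) → dist a a ≡ 0
    dist-self a = ∣n-n∣≡0 (toℕ a)

    dist-comm : (a b : Fin n) → dist a b ≡ dist b a
    dist-comm a b = ∣-∣-comm (toℕ a) (toℕ b)

    ∑-𝟙≢₂ : ∀ (a : Fin n) (h : Fin n → ℕ) → h a ≡ 0 → ∑[ b ∈ allFin n ] (𝟙≢₂ a b * h b) ≡ ∑ (allFin n) h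
    ∑-𝟙≢₂ a h ha≡0 = begin
      ∑[ b ∈ allFin n ] (𝟙≢₂ a b * h b)                         ≡⟨ sym (+-identityʳ _) ⟩
      ∑[ b ∈ allFin n ] (𝟙≢₂ a b * h b) + 1 * (0 + 0)            ≡⟨ cong (λ x → ∑[ b ∈ allFin n ] (𝟙≢₂ a b * h b) + 1 * (x + 0)) (sym ha≡0) ⟩
      ∑[ b ∈ allFin n ] (𝟙≢₂ a b * h b) + 1 * ∑ (a ∷ []) h       ≡⟨ ∑-fresh (a ∷ []) [] h ⟩
      1 * ∑ (allFin n) h                                          ≡⟨ *-identityˡ _ ⟩
      ∑ (allFin n) h                                              ∎
      where open ≡-Reasoning

    distinctPairDist distinctPairDistSq distinctTripleDist distinctQuadDist : ℕ
    distinctPairDist   = ∑₂ (λ a b → 𝟙≢₂ a b * dist a b)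
    distinctPairDistSq = ∑₂ (λ a b → 𝟙≢₂ a b * (dist a b * dist a b))
    distinctTripleDist = ∑₃ (λ a b c → 𝟙≢₃ a b c * (dist a b * dist a c))
    distinctQuadDist   = ∑₃ (λ a b c → ∑[ e ∈ allFin n ] (𝟙≢₄ a b c e * (dist a b * dist c e)))

    distinctPairDist≡totalDist : distinctPairDist ≡ totalDist n
    distinctPairDist≡totalDist = ∑-cong (allFin n) λ a → ∑-𝟙≢₂ a (dist a) (dist-self a)

    distinctPairDistSq≡totalDistSq : distinctPairDistSq ≡ totalDistSq n
    distinctPairDistSq≡totalDistSq =
      ∑-cong (allFin n) λ a → ∑-𝟙≢₂ a (λ b → dist a b * dist a b) (cong (λ x → x * x) (dist-self a))

    ∑₂-𝟙≢₂-dist-rowDist : ∑₂ (λ a b → 𝟙≢₂ a b * (dist a b * rowDist a)) ≡ totalRowDistSq n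
    ∑₂-𝟙≢₂-dist-rowDist = ∑-cong (allFin n) λ a →
      trans (∑-𝟙≢₂ a (λ b → dist a b * rowDist a) (cong (_* rowDist a) (dist-self a))) (∑-*ʳ (allFin n) (rowDist a) (dist a))

    ∑₂-𝟙≢₂-dist-rowDist′ : ∑₂ (λ a b → 𝟙≢₂ a b * (dist a b * rowDist b)) ≡ totalRowDistSq n
    ∑₂-𝟙≢₂-dist-rowDist′ = trans (∑₂-swap _) (trans (∑₂-cong (λ a b →
      cong₂ _*_ (𝟙≢₂-swap b a) (cong (_* rowDist a) (dist-comm b a)))) ∑₂-𝟙≢₂-dist-rowDist)

    distinctTriple+distSq : distinctTripleDist + totalDistSq n ≡ totalRowDistSq n
    distinctTriple+distSq = begin
      distinctTripleDist + totalDistSq n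
        ≡⟨ cong (distinctTripleDist +_) (sym distinctPairDistSq≡totalDistSq) ⟩
      distinctTripleDist + distinctPairDistSq
        ≡⟨ sym (∑₂-+ (λ a b → ∑[ c ∈ allFin n ] (𝟙≢₃ a b c * (dist a b * dist a c))) _) ⟩
      ∑₂ (λ a b → ∑[ c ∈ allFin n ] (𝟙≢₃ a b c * (dist a b * dist a c)) + 𝟙≢₂ a b * (dist a b * dist a b))
        ≡⟨ ∑₂-cong drop-third ⟩
      ∑₂ (λ a b → 𝟙≢₂ a b * (dist a b * rowDist a))
        ≡⟨ ∑₂-𝟙≢₂-dist-rowDist ⟩
      totalRowDistSq n ∎
      where
      open ≡-Reasoning
      drop-third : (a b : Fin n) → ∑[ c ∈ allFin n ] (𝟙≢₃ a b c * (dist a b * dist a c)) + 𝟙≢₂ a b * (dist a b * dist a b)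
                           ≡ 𝟙≢₂ a b * (dist a b * rowDist a)
      drop-third a b = begin
        S + 𝟙≢₂ a b * (dist a b * dist a b)
          ≡⟨ cong (λ x → S + 𝟙≢₂ a b * x) (sym (trans (cong (λ y → dist a b * y + (dist a b * dist a b + 0)) (dist-self a))
                                                      (trans (cong (_+ (dist a b * dist a b + 0)) (*-zeroʳ (dist a b))) (+-identityʳ _)))) ⟩
        S + 𝟙≢₂ a b * ∑ (a ∷ b ∷ []) (λ c → dist a b * dist a c)
          ≡⟨ ∑-fresh (a ∷ b ∷ []) [] (λ c → dist a b * dist a c) ⟩
        𝟙≢₂ a b * ∑[ c ∈ allFin n ] (dist a b * dist a c)
          ≡⟨ cong (𝟙≢₂ a b *_) (∑-*ˡ (allFin n) (dist a b) (dist a)) ⟩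
        𝟙≢₂ a b * (dist a b * rowDist a) ∎
        where S = ∑[ c ∈ allFin n ] (𝟙≢₃ a b c * (dist a b * dist a c))

    distinctTripleDist-swap : ∑₃ (λ a b c → 𝟙≢₃ a b c * (dist a b * dist c b)) ≡ distinctTripleDist
    distinctTripleDist-swap = trans (∑-swap (allFin n) (allFin n) _) (∑₃-cong (λ a b c →
      cong₂ _*_ (𝟙≢₃-swap b a c) (cong₂ _*_ (dist-comm b a) (dist-comm c a))))

    distinctQuad+triples : distinctQuadDist + (distinctTripleDist + distinctTripleDist)
                           ≡ ∑₃ (λ a b c → 𝟙≢₃ a b c * (dist a b * rowDist c))
    distinctQuad+triples = begin
      distinctQuadDist + (distinctTripleDist + distinctTripleDist)
        ≡⟨ cong (distinctQuadDist +_) (sym (cong₂ _+_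
             (∑₃-cong (λ a b c → cong (λ x → 𝟙≢₃ a b c * (dist a b * x)) (dist-comm c a))) distinctTripleDist-swap)) ⟩
      distinctQuadDist + (∑₃ (λ a b c → 𝟙≢₃ a b c * (dist a b * dist c a)) + ∑₃ (λ a b c → 𝟙≢₃ a b c * (dist a b * dist c b)))
        ≡⟨ cong (distinctQuadDist +_) (sym (∑₃-+ _ _)) ⟩
      distinctQuadDist + ∑₃ (λ a b c → 𝟙≢₃ a b c * (dist a b * dist c a) + 𝟙≢₃ a b c * (dist a b * dist c b))
        ≡⟨ sym (∑₃-+ _ _) ⟩
      ∑₃ (λ a b c → ∑[ e ∈ allFin n ] (𝟙≢₄ a b c e * (dist a b * dist c e))
                    + (𝟙≢₃ a b c * (dist a b * dist c a) + 𝟙≢₃ a b c * (dist a b * dist c b)))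
        ≡⟨ ∑₃-cong drop-fourth ⟩
      ∑₃ (λ a b c → 𝟙≢₃ a b c * (dist a b * rowDist c)) ∎
      where
      open ≡-Reasoning
      drop-fourth : (a b c : Fin n) →
        ∑[ e ∈ allFin n ] (𝟙≢₄ a b c e * (dist a b * dist c e)) + (𝟙≢₃ a b c * (dist a b * dist c a) + 𝟙≢₃ a b c * (dist a b * dist c b))
          ≡ 𝟙≢₃ a b c * (dist a b * rowDist c)
      drop-fourth a b c = begin
        S + (𝟙≢₃ a b c * (dist a b * dist c a) + 𝟙≢₃ a b c * (dist a b * dist c b))
          ≡⟨ cong (S +_) (sym (*-distribˡ-+ (𝟙≢₃ a b c) _ _)) ⟩
        S + 𝟙≢₃ a b c * (dist a b * dist c a + dist a b * dist c b)
          ≡⟨ cong (λ x → S + 𝟙≢₃ a b c * x) (sym on-list) ⟩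
        S + 𝟙≢₃ a b c * ∑ (a ∷ b ∷ c ∷ []) (λ e → dist a b * dist c e)
          ≡⟨ ∑-fresh (a ∷ b ∷ c ∷ []) [] (λ e → dist a b * dist c e) ⟩
        𝟙≢₃ a b c * ∑[ e ∈ allFin n ] (dist a b * dist c e)
          ≡⟨ cong (𝟙≢₃ a b c *_) (∑-*ˡ (allFin n) (dist a b) (dist c)) ⟩
        𝟙≢₃ a b c * (dist a b * rowDist c) ∎
        where
        S = ∑[ e ∈ allFin n ] (𝟙≢₄ a b c e * (dist a b * dist c e))
        on-list : ∑ (a ∷ b ∷ c ∷ []) (λ e → dist a b * dist c e) ≡ dist a b * dist c a + dist a b * dist c b
        on-list rewrite dist-self c | *-zeroʳ (dist a b) = cong (dist a b * dist c a +_) (+-identityʳ _)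

    triples+rowDistSq : ∑₃ (λ a b c → 𝟙≢₃ a b c * (dist a b * rowDist c)) + (totalRowDistSq n + totalRowDistSq n)
                        ≡ totalDist n * totalDist n
    triples+rowDistSq = begin
      S₃ + (totalRowDistSq n + totalRowDistSq n)
        ≡⟨ cong (S₃ +_) (sym (cong₂ _+_ ∑₂-𝟙≢₂-dist-rowDist ∑₂-𝟙≢₂-dist-rowDist′)) ⟩
      S₃ + (∑₂ (λ a b → 𝟙≢₂ a b * (dist a b * rowDist a)) + ∑₂ (λ a b → 𝟙≢₂ a b * (dist a b * rowDist b)))
        ≡⟨ cong (S₃ +_) (sym (∑₂-+ _ _)) ⟩
      S₃ + ∑₂ (λ a b → 𝟙≢₂ a b * (dist a b * rowDist a) + 𝟙≢₂ a b * (dist a b * rowDist b))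
        ≡⟨ sym (∑₂-+ _ _) ⟩
      ∑₂ (λ a b → ∑[ c ∈ allFin n ] (𝟙≢₃ a b c * (dist a b * rowDist c))
                  + (𝟙≢₂ a b * (dist a b * rowDist a) + 𝟙≢₂ a b * (dist a b * rowDist b)))
        ≡⟨ ∑₂-cong drop-third ⟩
      ∑₂ (λ a b → 𝟙≢₂ a b * (dist a b * totalDist n))
        ≡⟨ ∑-cong (allFin n) (λ a → trans (∑-𝟙≢₂ a (λ b → dist a b * totalDist n) (cong (_* totalDist n) (dist-self a)))
                                          (∑-*ʳ (allFin n) (totalDist n) (dist a))) ⟩
      ∑[ a ∈ allFin n ] (rowDist a * totalDist n)
        ≡⟨ ∑-*ʳ (allFin n) (totalDist n) rowDist ⟩
      totalDist n * totalDist n ∎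
      where
      open ≡-Reasoning
      S₃ = ∑₃ (λ a b c → 𝟙≢₃ a b c * (dist a b * rowDist c))
      drop-third : (a b : Fin n) →
        ∑[ c ∈ allFin n ] (𝟙≢₃ a b c * (dist a b * rowDist c)) + (𝟙≢₂ a b * (dist a b * rowDist a) + 𝟙≢₂ a b * (dist a b * rowDist b))
          ≡ 𝟙≢₂ a b * (dist a b * totalDist n)
      drop-third a b = begin
        S + (𝟙≢₂ a b * (dist a b * rowDist a) + 𝟙≢₂ a b * (dist a b * rowDist b))
          ≡⟨ cong (S +_) (sym (*-distribˡ-+ (𝟙≢₂ a b) _ _)) ⟩
        S + 𝟙≢₂ a b * (dist a b * rowDist a + dist a b * rowDist b)
          ≡⟨ cong (λ x → S + 𝟙≢₂ a b * (dist a b * rowDist a + x)) (sym (+-identityʳ _)) ⟩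
        S + 𝟙≢₂ a b * ∑ (a ∷ b ∷ []) (λ c → dist a b * rowDist c)
          ≡⟨ ∑-fresh (a ∷ b ∷ []) [] (λ c → dist a b * rowDist c) ⟩
        𝟙≢₂ a b * ∑[ c ∈ allFin n ] (dist a b * rowDist c)
          ≡⟨ cong (𝟙≢₂ a b *_) (∑-*ˡ (allFin n) (dist a b) rowDist) ⟩
        𝟙≢₂ a b * (dist a b * totalDist n) ∎
        where S = ∑[ c ∈ allFin n ] (𝟙≢₃ a b c * (dist a b * rowDist c))

    distinctQuad-identity : distinctQuadDist + (distinctTripleDist + distinctTripleDist) + (totalRowDistSq n + totalRowDistSq n)
                            ≡ totalDist n * totalDist n
    distinctQuad-identity = trans (cong (_+ (totalRowDistSq n + totalRowDistSq n)) distinctQuad+triples) triples+rowDistSq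

module EdgeMoments where

  open import Data.Nat using (_+_; _*_; _∸_; _!; _^_)
  open import Data.Nat.Properties hiding (_≟_; suc-injective)
  open import Data.Nat.Properties using () renaming (_≟_ to _≟ℕ_)
  open import Data.Nat.Tactic.RingSolver using (solve-∀)
  open import Relation.Nullary.Decidable using (_⊎-dec_)
  import Data.List.Relation.Unary.All as All
  open Sums
  open InjectiveSums
  open Distances

  LoopFree : ∀ {n} → Edge n → Set
  LoopFree e = ¬ proj₁ e ≡ proj₂ e

  pairWeight : ℕ → ℕ → ℕ
  pairWeight n 0 = (n ∸ 4) ! * distinctQuadDist {n}
  pairWeight n 1 = (n ∸ 3) ! * distinctTripleDist {n}
  pairWeight n 2 = (n ∸ 2) ! * distinctPairDistSq {n}
  pairWeight n _ = 0   -- two loop-free edges share at most two endpoints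

  module _ {n : ℕ} where

    injSum-two : (G : Vec (Fin n) 2 → ℕ) → injSum [] 2 G ≡ ∑₂ (λ a b → 𝟙≢₂ a b * G (a ∷ᵥ b ∷ᵥ []ᵥ))
    injSum-two G = trans (injSum-suc [] 1 G) (∑-cong (allFin n) λ a → trans (injSum-suc (a ∷ []) 0 _)
      (∑-cong (allFin n) λ b → injSum-zero (a ∷ b ∷ []) (λ w → G (a ∷ᵥ b ∷ᵥ w))))

    injSum-three : (G : Vec (Fin n) 3 → ℕ) →
      injSum [] 3 G ≡ ∑₃ (λ a b c → 𝟙≢₃ a b c * G (a ∷ᵥ b ∷ᵥ c ∷ᵥ []ᵥ))
    injSum-three G = trans (injSum-suc [] 2 G) (∑-cong (allFin n) λ a → trans (injSum-suc (a ∷ []) 1 _)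
      (∑-cong (allFin n) λ b → trans (injSum-suc (a ∷ b ∷ []) 0 _)
      (∑-cong (allFin n) λ c → injSum-zero (a ∷ b ∷ c ∷ []) (λ w → G (a ∷ᵥ b ∷ᵥ c ∷ᵥ w)))))

    injSum-four : (G : Vec (Fin n) 4 → ℕ) →
      injSum [] 4 G ≡ ∑₃ (λ a b c → ∑[ e ∈ allFin n ] (𝟙≢₄ a b c e * G (a ∷ᵥ b ∷ᵥ c ∷ᵥ e ∷ᵥ []ᵥ)))
    injSum-four G = trans (injSum-suc [] 3 G) (∑-cong (allFin n) λ a → trans (injSum-suc (a ∷ []) 2 _)
      (∑-cong (allFin n) λ b → trans (injSum-suc (a ∷ b ∷ []) 1 _)
      (∑-cong (allFin n) λ c → trans (injSum-suc (a ∷ b ∷ c ∷ []) 0 _)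
      (∑-cong (allFin n) λ e → injSum-zero (a ∷ b ∷ c ∷ e ∷ []) (λ w → G (a ∷ᵥ b ∷ᵥ c ∷ᵥ e ∷ᵥ w))))))

    edgeLength : Vec (Fin n) n → Edge n → ℕ
    edgeLength π e = dist (lookup π (proj₁ e)) (lookup π (proj₂ e))

    pairMoment : Edge n → Edge n → ℕ
    pairMoment e f = injSum [] n (λ π → edgeLength π e * edgeLength π f)

    sharedEnds : Edge n → Edge n → ℕ
    sharedEnds (u , v) (x , y) = 𝟙 (u ≟ x) + 𝟙 (u ≟ y) + 𝟙 (v ≟ x) + 𝟙 (v ≟ y)

    edgeMoment : ∀ u v → ¬ u ≡ v → injSum [] n (λ π → edgeLength π (u , v)) ≡ (n ∸ 2) ! * distinctPairDist {n}
    edgeMoment u v u≢v = trans (injSum-restrict n [] (u ∷ᵥ v ∷ᵥ []ᵥ) ((u≢v ∷ []) ∷ [] ∷ []) refl G)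
                               (cong ((n ∸ 2) ! *_) (injSum-two G))
      where
      G : Vec (Fin n) 2 → ℕ
      G (a ∷ᵥ b ∷ᵥ []ᵥ) = dist a b

    moment-same : ∀ u v → ¬ u ≡ v → pairMoment (u , v) (u , v) ≡ pairWeight n 2
    moment-same u v u≢v = trans (injSum-restrict n [] (u ∷ᵥ v ∷ᵥ []ᵥ) ((u≢v ∷ []) ∷ [] ∷ []) refl G)
                                (cong ((n ∸ 2) ! *_) (injSum-two G))
      where
      G : Vec (Fin n) 2 → ℕ
      G (a ∷ᵥ b ∷ᵥ []ᵥ) = dist a b * dist a b

    moment-adjacent : ∀ u v y → ¬ u ≡ v → ¬ u ≡ y → ¬ v ≡ y → pairMoment (u , v) (u , y) ≡ pairWeight n 1
    moment-adjacent u v y u≢v u≢y v≢y =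
      trans (injSum-restrict n [] (u ∷ᵥ v ∷ᵥ y ∷ᵥ []ᵥ) ((u≢v ∷ u≢y ∷ []) ∷ (v≢y ∷ []) ∷ [] ∷ []) refl G)
            (cong ((n ∸ 3) ! *_) (injSum-three G))
      where
      G : Vec (Fin n) 3 → ℕ
      G (a ∷ᵥ b ∷ᵥ c ∷ᵥ []ᵥ) = dist a b * dist a c

    moment-disjoint : ∀ u v x y → Unique (u ∷ v ∷ x ∷ y ∷ []) → pairMoment (u , v) (x , y) ≡ pairWeight n 0
    moment-disjoint u v x y distinct =
      trans (injSum-restrict n [] (u ∷ᵥ v ∷ᵥ x ∷ᵥ y ∷ᵥ []ᵥ) distinct refl G)
            (cong ((n ∸ 4) ! *_) (injSum-four G))
      where
      G : Vec (Fin n) 4 → ℕ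
      G (a ∷ᵥ b ∷ᵥ c ∷ᵥ e ∷ᵥ []ᵥ) = dist a b * dist c e

    edgeLength-flip : ∀ π (u v : Fin n) → edgeLength π (u , v) ≡ edgeLength π (v , u)
    edgeLength-flip π u v = dist-comm (lookup π u) (lookup π v)

    data OverlapClass (e f : Edge n) : ℕ → Set where
      shares-two  : SameEdge e f → pairMoment e f ≡ pairWeight n 2 → OverlapClass e f 2
      shares-one  : pairMoment e f ≡ pairWeight n 1 → OverlapClass e f 1
      shares-none : Unique (proj₁ e ∷ proj₂ e ∷ proj₁ f ∷ proj₂ f ∷ []) → pairMoment e f ≡ pairWeight n 0 → OverlapClass e f 0

    classify : ∀ e f → LoopFree e → LoopFree f → OverlapClass e f (sharedEnds e f)
    classify (u , v) (x , y) u≢v x≢y with u ≟ x | u ≟ y | v ≟ x | v ≟ y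
    ... | yes refl | yes refl | _        | _        = ⊥-elim (x≢y refl)
    ... | yes refl | no _     | yes refl | _        = ⊥-elim (u≢v refl)
    ... | yes refl | no _     | no _     | yes refl = shares-two (inj₁ refl) (moment-same u v u≢v)
    ... | yes refl | no u≢y   | no _     | no v≢y   =
      shares-one (moment-adjacent u v y u≢v u≢y v≢y)
    ... | no _     | yes refl | yes refl | yes refl = ⊥-elim (u≢v refl)
    ... | no _     | yes refl | yes refl | no _     = shares-two (inj₂ refl)
      (trans (injSum-cong [] n (λ π → cong (edgeLength π (u , v) *_) (edgeLength-flip π v u))) (moment-same u v u≢v))
    ... | no _     | yes refl | no _     | yes refl = ⊥-elim (u≢v refl)
    ... | no u≢x   | yes refl | no v≢x   | no _     = shares-one
      (trans (injSum-cong [] n (λ π → cong (edgeLength π (u , v) *_) (edgeLength-flip π x u))) (moment-adjacent u v x u≢v u≢x v≢x))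
    ... | no _     | no _     | yes refl | yes refl = ⊥-elim (x≢y refl)
    ... | no u≢x   | no u≢y   | yes refl | no _     = shares-one
      (trans (injSum-cong [] n (λ π → cong (_* edgeLength π (v , y)) (edgeLength-flip π u v))) (moment-adjacent v u y (u≢v ∘ sym) x≢y u≢y))
    ... | no u≢x   | no _     | no _     | yes refl = shares-one
      (trans (injSum-cong [] n (λ π → cong₂ _*_ (edgeLength-flip π u v) (edgeLength-flip π x v)))
             (moment-adjacent v u x (u≢v ∘ sym) (x≢y ∘ sym) u≢x))
    ... | no u≢x   | no u≢y   | no v≢x   | no v≢y   = shares-none distinct (moment-disjoint u v x y distinct)
      where
      distinct : Unique (u ∷ v ∷ x ∷ y ∷ [])
      distinct = (u≢v ∷ u≢x ∷ u≢y ∷ []) ∷ (v≢x ∷ v≢y ∷ []) ∷ (x≢y ∷ []) ∷ [] ∷ []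

    class-moment : ∀ {e f k} → OverlapClass e f k → pairMoment e f ≡ pairWeight n k
    class-moment (shares-two _ m)  = m
    class-moment (shares-one m)    = m
    class-moment (shares-none _ m) = m

    class-SameEdge : ∀ {e f k} → OverlapClass e f k → k ≡ 2 → SameEdge e f
    class-SameEdge (shares-two same _) _ = same

    class-weight : ∀ {e f k} → OverlapClass e f k →
      pairWeight n k ≡ 𝟙 (k ≟ℕ 0) * pairWeight n 0 + 𝟙 (k ≟ℕ 1) * pairWeight n 1 + 𝟙 (k ≟ℕ 2) * pairWeight n 2
    class-weight (shares-two _ _)  = sym (+-identityʳ _)
    class-weight (shares-one _)    = sym (trans (+-identityʳ _) (+-identityʳ _))
    class-weight (shares-none _ _) = sym (trans (+-identityʳ _) (trans (+-identityʳ _) (+-identityʳ _)))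

    class-partition : ∀ {e f k} → OverlapClass e f k → 𝟙 (k ≟ℕ 0) + 𝟙 (k ≟ℕ 1) + 𝟙 (k ≟ℕ 2) ≡ 1
    class-partition (shares-two _ _)  = refl
    class-partition (shares-one _)    = refl
    class-partition (shares-none _ _) = refl

    class-sharedEnds : ∀ {e f k} → OverlapClass e f k → 𝟙 (k ≟ℕ 1) + 2 * 𝟙 (k ≟ℕ 2) ≡ k
    class-sharedEnds (shares-two _ _)  = refl
    class-sharedEnds (shares-one _)    = refl
    class-sharedEnds (shares-none _ _) = refl

    incidence : Edge n → Fin n → ℕ
    incidence e i = 𝟙 (proj₁ e ≟ i) + 𝟙 (proj₂ e ≟ i)

    ∑-incidence² : ∀ e f → ∑[ i ∈ allFin n ] (incidence e i * incidence f i) ≡ sharedEnds e f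
    ∑-incidence² (u , v) (x , y) = begin
      ∑[ i ∈ allFin n ] ((𝟙 (u ≟ i) + 𝟙 (v ≟ i)) * (𝟙 (x ≟ i) + 𝟙 (y ≟ i)))
        ≡⟨ ∑-cong (allFin n) (λ i → expand (𝟙 (u ≟ i)) (𝟙 (v ≟ i)) (𝟙 (x ≟ i)) (𝟙 (y ≟ i))) ⟩
      ∑[ i ∈ allFin n ] (𝟙 (u ≟ i) * 𝟙 (x ≟ i) + 𝟙 (u ≟ i) * 𝟙 (y ≟ i) + 𝟙 (v ≟ i) * 𝟙 (x ≟ i) + 𝟙 (v ≟ i) * 𝟙 (y ≟ i))
        ≡⟨ trans (∑-+ (allFin n) _ _) (cong (_+ _) (trans (∑-+ (allFin n) _ _) (cong (_+ _) (∑-+ (allFin n) _ _)))) ⟩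
      ∑[ i ∈ allFin n ] (𝟙 (u ≟ i) * 𝟙 (x ≟ i)) + ∑[ i ∈ allFin n ] (𝟙 (u ≟ i) * 𝟙 (y ≟ i))
        + ∑[ i ∈ allFin n ] (𝟙 (v ≟ i) * 𝟙 (x ≟ i)) + ∑[ i ∈ allFin n ] (𝟙 (v ≟ i) * 𝟙 (y ≟ i))
        ≡⟨ cong₂ _+_ (cong₂ _+_ (cong₂ _+_ (coincide u x) (coincide u y)) (coincide v x)) (coincide v y) ⟩
      sharedEnds (u , v) (x , y) ∎
      where
      open ≡-Reasoning
      expand : ∀ p q r s → (p + q) * (r + s) ≡ p * r + p * s + q * r + q * s
      expand = solve-∀
      coincide : ∀ (a b : Fin n) → ∑[ i ∈ allFin n ] (𝟙 (a ≟ i) * 𝟙 (b ≟ i)) ≡ 𝟙 (a ≟ b)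
      coincide a b = trans (∑-cong (allFin n) (λ i → cong (_* 𝟙 (b ≟ i)) (𝟙-≟-sym a i)))
                           (trans (∑-point a (λ i → 𝟙 (b ≟ i))) (𝟙-≟-sym b a))

    injSum-∑ : ∀ {a} {A : Set a} S m (xs : List A) (h : Vec (Fin n) m → A → ℕ) →
               injSum S m (λ w → ∑ xs (h w)) ≡ ∑[ x ∈ xs ] injSum S m (λ w → h w x)
    injSum-∑ S m xs h = trans (∑-cong (allVecs n m) (λ w → sym (∑-*ˡ xs (𝟙 (unique? (S ++ toList w))) (h w))))
                              (∑-swap (allVecs n m) xs _)

    arrangement-count : injSum [] n (λ _ → 1) ≡ n !
    arrangement-count = trans (injSum-restrict n [] []ᵥ [] refl (λ _ → 1)) (*-identityʳ (n !))

  module _ {n : ℕ} (E : List (Edge n)) where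

    ∑∑ : (Edge n → Edge n → ℕ) → ℕ
    ∑∑ g = ∑[ e ∈ E ] ∑[ f ∈ E ] g e f

    ∑∑-cong : ∀ {g h} → All LoopFree E → (∀ e f → LoopFree e → LoopFree f → g e f ≡ h e f) → ∑∑ g ≡ ∑∑ h
    ∑∑-cong loopFree eq = ∑-cong-All E loopFree (λ e le → ∑-cong-All E loopFree (λ f lf → eq e f le lf))

    ∑∑-+ : ∀ g h → ∑∑ (λ e f → g e f + h e f) ≡ ∑∑ g + ∑∑ h
    ∑∑-+ g h = trans (∑-cong E (λ e → ∑-+ E (g e) (h e))) (∑-+ E _ _)

    ∑∑-*ʳ : ∀ g c → ∑∑ (λ e f → g e f * c) ≡ ∑∑ g * c
    ∑∑-*ʳ g c = trans (∑-cong E (λ e → ∑-*ʳ E c (g e))) (∑-*ʳ E c _)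

    pairCount : ℕ → ℕ
    pairCount k = ∑∑ (λ e f → 𝟙 (sharedEnds e f ≟ℕ k))

    injSum-D : All LoopFree E → injSum [] n (D E) ≡ length E * ((n ∸ 2) ! * distinctPairDist {n})
    injSum-D loopFree = trans (injSum-∑ [] n E edgeLength)
      (trans (∑-cong-All E loopFree (λ e le → edgeMoment (proj₁ e) (proj₂ e) le)) (∑-const E _))

    injSum-D² : injSum [] n (λ π → D E π ^ 2) ≡ ∑∑ pairMoment
    injSum-D² = begin
      injSum [] n (λ π → D E π ^ 2)
        ≡⟨ injSum-cong [] n (λ π → trans (cong (D E π *_) (*-identityʳ _))
             (trans (sym (∑-*ʳ E (D E π) (edgeLength π))) (∑-cong E (λ e → sym (∑-*ˡ E (edgeLength π e) (edgeLength π)))))) ⟩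
      injSum [] n (λ π → ∑∑ (λ e f → edgeLength π e * edgeLength π f))
        ≡⟨ injSum-∑ [] n E _ ⟩
      ∑[ e ∈ E ] injSum [] n (λ π → ∑[ f ∈ E ] (edgeLength π e * edgeLength π f))
        ≡⟨ ∑-cong E (λ e → injSum-∑ [] n E _) ⟩
      ∑∑ pairMoment ∎
      where open ≡-Reasoning

    module _ (loopFree : All LoopFree E) where

      ∑∑-pairMoment : ∑∑ pairMoment ≡ pairCount 0 * pairWeight n 0 + pairCount 1 * pairWeight n 1 + pairCount 2 * pairWeight n 2
      ∑∑-pairMoment = begin
        ∑∑ pairMoment
          ≡⟨ ∑∑-cong loopFree (λ e f le lf → let c = classify e f le lf in trans (class-moment c) (class-weight c)) ⟩
        ∑∑ (λ e f → 𝟙 (sharedEnds e f ≟ℕ 0) * pairWeight n 0 + 𝟙 (sharedEnds e f ≟ℕ 1) * pairWeight n 1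
                    + 𝟙 (sharedEnds e f ≟ℕ 2) * pairWeight n 2)
          ≡⟨ ∑∑-+ _ _ ⟩
        ∑∑ (λ e f → 𝟙 (sharedEnds e f ≟ℕ 0) * pairWeight n 0 + 𝟙 (sharedEnds e f ≟ℕ 1) * pairWeight n 1)
          + ∑∑ (λ e f → 𝟙 (sharedEnds e f ≟ℕ 2) * pairWeight n 2)
          ≡⟨ cong₂ _+_ (trans (∑∑-+ _ _) (cong₂ _+_ (∑∑-*ʳ _ _) (∑∑-*ʳ _ _))) (∑∑-*ʳ _ _) ⟩
        pairCount 0 * pairWeight n 0 + pairCount 1 * pairWeight n 1 + pairCount 2 * pairWeight n 2 ∎
        where open ≡-Reasoning

      pairCount-total : pairCount 0 + pairCount 1 + pairCount 2 ≡ length E * length E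
      pairCount-total = begin
        pairCount 0 + pairCount 1 + pairCount 2
          ≡⟨ cong (_+ pairCount 2) (sym (∑∑-+ _ _)) ⟩
        ∑∑ (λ e f → 𝟙 (sharedEnds e f ≟ℕ 0) + 𝟙 (sharedEnds e f ≟ℕ 1)) + pairCount 2
          ≡⟨ sym (∑∑-+ _ _) ⟩
        ∑∑ (λ e f → 𝟙 (sharedEnds e f ≟ℕ 0) + 𝟙 (sharedEnds e f ≟ℕ 1) + 𝟙 (sharedEnds e f ≟ℕ 2))
          ≡⟨ ∑∑-cong loopFree (λ e f le lf → class-partition (classify e f le lf)) ⟩
        ∑∑ (λ _ _ → 1)
          ≡⟨ trans (∑-cong E (λ _ → ∑-const E 1)) (∑-const E (length E * 1)) ⟩
        length E * (length E * 1)
          ≡⟨ cong (length E *_) (*-identityʳ _) ⟩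
        length E * length E ∎
        where open ≡-Reasoning

      pairCount-sharedEnds : pairCount 1 + 2 * pairCount 2 ≡ ∑∑ sharedEnds
      pairCount-sharedEnds = begin
        pairCount 1 + 2 * pairCount 2
          ≡⟨ cong (pairCount 1 +_) (trans (*-comm 2 (pairCount 2)) (sym (∑∑-*ʳ _ 2))) ⟩
        pairCount 1 + ∑∑ (λ e f → 𝟙 (sharedEnds e f ≟ℕ 2) * 2)
          ≡⟨ sym (∑∑-+ _ _) ⟩
        ∑∑ (λ e f → 𝟙 (sharedEnds e f ≟ℕ 1) + 𝟙 (sharedEnds e f ≟ℕ 2) * 2)
          ≡⟨ ∑∑-cong loopFree (λ e f le lf → trans (cong (𝟙 (sharedEnds e f ≟ℕ 1) +_) (*-comm (𝟙 (sharedEnds e f ≟ℕ 2)) 2))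
                                                      (class-sharedEnds (classify e f le lf))) ⟩
        ∑∑ sharedEnds ∎
        where open ≡-Reasoning

      degree-∑ : ∀ i → degree E i ≡ ∑[ e ∈ E ] incidence e i
      degree-∑ i = trans (length-filter (λ e → (proj₁ e ≟ i) ⊎-dec (proj₂ e ≟ i)) E)
                         (∑-cong-All E loopFree (λ e le → 𝟙-⊎ e le))
        where
        𝟙-⊎ : ∀ e → LoopFree e → 𝟙 ((proj₁ e ≟ i) ⊎-dec (proj₂ e ≟ i)) ≡ incidence e i
        𝟙-⊎ (u , v) u≢v with u ≟ i | v ≟ i
        ... | yes refl | yes refl = ⊥-elim (u≢v refl)
        ... | yes _    | no _     = refl
        ... | no _     | yes _    = refl
        ... | no _     | no _     = refl

      ∑∑-sharedEnds : ∑∑ sharedEnds ≡ sumDegSq n E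
      ∑∑-sharedEnds = sym (begin
        ∑[ i ∈ allFin n ] (degree E i ^ 2)
          ≡⟨ ∑-cong (allFin n) (λ i → trans (cong (λ d → d * (d * 1)) (degree-∑ i)) (cong (∑[ e ∈ E ] incidence e i *_) (*-identityʳ _))) ⟩
        ∑[ i ∈ allFin n ] (∑[ e ∈ E ] incidence e i * ∑[ f ∈ E ] incidence f i)
          ≡⟨ ∑-cong (allFin n) (λ i → trans (sym (∑-*ʳ E _ (λ e → incidence e i)))
                                            (∑-cong E (λ e → sym (∑-*ˡ E (incidence e i) (λ f → incidence f i))))) ⟩
        ∑[ i ∈ allFin n ] ∑[ e ∈ E ] ∑[ f ∈ E ] (incidence e i * incidence f i)
          ≡⟨ ∑-swap (allFin n) E _ ⟩
        ∑[ e ∈ E ] ∑[ i ∈ allFin n ] ∑[ f ∈ E ] (incidence e i * incidence f i)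
          ≡⟨ ∑-cong E (λ e → ∑-swap (allFin n) E _) ⟩
        ∑∑ (λ e f → ∑[ i ∈ allFin n ] (incidence e i * incidence f i))
          ≡⟨ ∑-cong E (λ e → ∑-cong E (λ f → ∑-incidence² e f)) ⟩
        ∑∑ sharedEnds ∎)
        where open ≡-Reasoning

  sharedEnds-self : ∀ {n} (e : Edge n) → LoopFree e → sharedEnds e e ≡ 2
  sharedEnds-self (u , v) u≢v with u ≟ u | u ≟ v | v ≟ u | v ≟ v
  ... | yes _ | no _  | no _  | yes _ = refl
  ... | no ¬r | _     | _     | _     = ⊥-elim (¬r refl)
  ... | _     | yes p | _     | _     = ⊥-elim (u≢v p)
  ... | _     | _     | yes p | _     = ⊥-elim (u≢v (sym p))
  ... | _     | _     | _     | no ¬r = ⊥-elim (¬r refl)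

  SameEdge-sym : ∀ {n} {e f : Edge n} → SameEdge e f → SameEdge f e
  SameEdge-sym (inj₁ refl) = inj₁ refl
  SameEdge-sym (inj₂ refl) = inj₂ refl

  pairCount-two : ∀ {n} (E : List (Edge n)) → IsSimple E → pairCount E 2 ≡ length E
  pairCount-two []       _                            = refl
  pairCount-two {n} (e ∷ E) (le ∷ loopFree , e≁ ∷ simple) = begin
    (same e e + ∑[ f ∈ E ] same e f) + ∑[ f ∈ E ] (same f e + ∑[ g ∈ E ] same f g)
      ≡⟨ cong₂ _+_ (cong₂ _+_ (𝟙-yes (sharedEnds e e ≟ℕ 2) (sharedEnds-self e le))
                              (vanishes (same e) (λ f e≁f lf → 𝟙-no (sharedEnds e f ≟ℕ 2) (e≁f ∘ class-SameEdge (classify e f le lf)))))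
                   (∑-+ E _ _) ⟩
    (1 + 0) + (∑[ f ∈ E ] same f e + pairCount E 2)
      ≡⟨ cong (λ z → suc (z + pairCount E 2))
              (vanishes (λ f → same f e) (λ f e≁f lf →
                 𝟙-no (sharedEnds f e ≟ℕ 2) (e≁f ∘ SameEdge-sym ∘ class-SameEdge (classify f e lf le)))) ⟩
    1 + (0 + pairCount E 2)
      ≡⟨ cong suc (pairCount-two E (loopFree , simple)) ⟩
    suc (length E) ∎
    where
    open ≡-Reasoning
    same : Edge n → Edge n → ℕ
    same f g = 𝟙 (sharedEnds f g ≟ℕ 2)
    vanishes : ∀ (h : Edge n → ℕ) → (∀ f → ¬ SameEdge e f → LoopFree f → h f ≡ 0) → ∑ E h ≡ 0
    vanishes h h≡0 = trans (∑-cong-All E (All.zip (e≁ , loopFree)) (λ f (e≁f , lf) → h≡0 f e≁f lf)) (∑-zero E (λ _ → refl))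

  no-disjoint-edges-in-Fin3 : ∀ {e f : Edge 3} {k} → OverlapClass e f k → 𝟙 (k ≟ℕ 0) ≡ 0
  no-disjoint-edges-in-Fin3 (shares-two _ _)         = refl
  no-disjoint-edges-in-Fin3 (shares-one _)           = refl
  no-disjoint-edges-in-Fin3 (shares-none distinct _) = ⊥-elim (<⇒≱ (n<1+n 3) (length-≤ _ distinct))

  pairCount-zero-Fin3 : (E : List (Edge 3)) → All LoopFree E → pairCount E 0 ≡ 0
  pairCount-zero-Fin3 E loopFree =
    trans (∑∑-cong E loopFree (λ e f le lf → no-disjoint-edges-in-Fin3 (classify e f le lf))) (∑-zero E (λ _ → ∑-zero E (λ _ → refl)))

  second-moment-decomposition : ∀ {n} (E : List (Edge n)) → All LoopFree E →
    injSum [] n (λ π → D E π ^ 2) ≡ pairCount E 0 * pairWeight n 0 + pairCount E 1 * pairWeight n 1 + pairCount E 2 * pairWeight n 2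
  second-moment-decomposition E loopFree = trans (injSum-D² E) (∑∑-pairMoment E loopFree)

  degree-pairCount : ∀ {n} (E : List (Edge n)) → All LoopFree E → pairCount E 1 + 2 * pairCount E 2 ≡ sumDegSq n E
  degree-pairCount E loopFree = trans (pairCount-sharedEnds E loopFree) (∑∑-sharedEnds E loopFree)

module TreeEdges where

  open import Data.Nat using (_+_; _*_; _≤_; z≤n; s≤s)
  open import Data.Nat.Properties using (+-identityʳ; +-assoc; *-identityʳ)
  open import Data.Unit using (tt)
  import Data.List.Relation.Unary.All as All
  open Sums

  module _ {n : ℕ} where

    Adj-weaken : ∀ {E : List (Edge n)} {e a b} → Adj E a b → Adj (e ∷ E) a b
    Adj-weaken (inj₁ m) = inj₁ (there m)
    Adj-weaken (inj₂ m) = inj₂ (there m)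

    Walk-weaken : ∀ {E : List (Edge n)} {e a b} → Walk E a b → Walk (e ∷ E) a b
    Walk-weaken here       = here
    Walk-weaken (step x w) = step (Adj-weaken x) (Walk-weaken w)

    Walk-++ : ∀ {E : List (Edge n)} {a b c} → Walk E a b → Walk E b c → Walk E a c
    Walk-++ here       w′ = w′
    Walk-++ (step x w) w′ = step x (Walk-++ w w′)

    Chain-weaken : ∀ {E : List (Edge n)} {e} (vs : List (Fin n)) → Chain E vs → Chain (e ∷ E) vs
    Chain-weaken []           c       = tt
    Chain-weaken (a ∷ [])     c       = tt
    Chain-weaken (a ∷ b ∷ vs) (x , c) = Adj-weaken x , Chain-weaken (b ∷ vs) c

    Chain-tail : ∀ {E : List (Edge n)} a (vs : List (Fin n)) → Chain E (a ∷ vs) → Chain E vs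
    Chain-tail a []       c       = tt
    Chain-tail a (b ∷ vs) (x , c) = c

    HasCycle-weaken : ∀ {E : List (Edge n)} {e} → HasCycle E → HasCycle (e ∷ E)
    HasCycle-weaken (v , ws , len , u , c) = v , ws , len , u , Chain-weaken ((v ∷ ws) ++ [ v ]) c

    EndsAt : List (Fin n) → Fin n → Set
    EndsAt []           y = ⊥
    EndsAt (a ∷ [])     y = a ≡ y
    EndsAt (a ∷ b ∷ vs) y = EndsAt (b ∷ vs) y

    Path : List (Edge n) → Fin n → Fin n → Set
    Path E x y = Σ (List (Fin n)) λ vs → Unique (x ∷ vs) × Chain E (x ∷ vs) × EndsAt (x ∷ vs) y

    Path-suffix : ∀ {E : List (Edge n)} {x y} (vs : List (Fin n)) → x ∈ vs → Unique vs → Chain E vs → EndsAt vs y → Path E x y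
    Path-suffix (x ∷ vs)     (here refl) u       c ends = vs , u , c , ends
    Path-suffix (a ∷ b ∷ vs) (there x∈)  (_ ∷ u) c ends = Path-suffix (b ∷ vs) x∈ u (Chain-tail a (b ∷ vs) c) ends

    Walk⇒Path : ∀ {E : List (Edge n)} {x y} → Walk E x y → Path E x y
    Walk⇒Path here = [] , ([] ∷ []) , tt , refl
    Walk⇒Path {x = x} (step {v = z} adj w) with Walk⇒Path w
    ... | vs , u , c , ends with x ∈? (z ∷ vs)
    ...   | yes x∈ = Path-suffix (z ∷ vs) x∈ u c ends
    ...   | no x∉  = z ∷ vs , (¬Any⇒All¬ (z ∷ vs) x∉ ∷ u) , (adj , c) , ends

    Chain-close : ∀ {E : List (Edge n)} (vs : List (Fin n)) {y z} → Chain E vs → EndsAt vs y → Adj E y z → Chain E (vs ++ [ z ])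
    Chain-close (a ∷ [])     c       refl adj = adj , tt
    Chain-close (a ∷ b ∷ vs) (x , c) ends adj = x , Chain-close (b ∷ vs) c ends adj

    -- A walk from u to v closes up with the new edge uv into a cycle: since uv is not a
    -- multiple edge, the path has at least two further vertices.
    Walk⇒HasCycle : ∀ {E : List (Edge n)} {u v} → ¬ u ≡ v → All (λ f → ¬ SameEdge (u , v) f) E →
                    Walk E u v → HasCycle ((u , v) ∷ E)
    Walk⇒HasCycle {E} {u} {v} u≢v fresh w with Walk⇒Path w
    ... | []         , _ , _              , ends = ⊥-elim (u≢v ends)
    ... | a ∷ []     , _ , (inj₁ uv∈ , _) , refl = ⊥-elim (All.lookup fresh uv∈ (inj₁ refl))
    ... | a ∷ []     , _ , (inj₂ vu∈ , _) , refl = ⊥-elim (All.lookup fresh vu∈ (inj₂ refl))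
    ... | a ∷ b ∷ vs , distinct , c       , ends = u , a ∷ b ∷ vs , s≤s (s≤s z≤n) , distinct ,
          Chain-close (u ∷ a ∷ b ∷ vs) (Chain-weaken (u ∷ a ∷ b ∷ vs) c) ends (inj₂ (here refl))

    -- Union-find style labelling: root E x is the representative of the component of x.
    redirect : Fin n → Fin n → Fin n → Fin n
    redirect p q y with y ≟ q
    ... | yes _ = p
    ... | no _  = y

    redirect-hit : ∀ p q y → y ≡ q → redirect p q y ≡ p
    redirect-hit p q y y≡q with y ≟ q
    ... | yes _  = refl
    ... | no y≢q = ⊥-elim (y≢q y≡q)

    redirect-miss : ∀ p q y → ¬ y ≡ q → redirect p q y ≡ y
    redirect-miss p q y y≢q with y ≟ q
    ... | yes y≡q = ⊥-elim (y≢q y≡q)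
    ... | no _    = refl

    redirect-source : ∀ p q → redirect p q p ≡ p
    redirect-source p q with p ≟ q
    ... | yes _ = refl
    ... | no _  = refl

    root : List (Edge n) → Fin n → Fin n
    root []            x = x
    root ((u , v) ∷ E) x = redirect (root E u) (root E v) (root E x)

    root-idempotent : ∀ (E : List (Edge n)) x → root E (root E x) ≡ root E x
    root-idempotent []            x = refl
    root-idempotent ((u , v) ∷ E) x with root E x ≟ root E v
    ... | yes hit = begin
      redirect (root E u) (root E v) (root E (root E u)) ≡⟨ cong (redirect (root E u) (root E v)) (root-idempotent E u) ⟩
      redirect (root E u) (root E v) (root E u)          ≡⟨ redirect-source (root E u) (root E v) ⟩
      root E u                                           ∎
      where open ≡-Reasoning
    ... | no miss = begin
      redirect (root E u) (root E v) (root E (root E x)) ≡⟨ cong (redirect (root E u) (root E v)) (root-idempotent E x) ⟩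
      redirect (root E u) (root E v) (root E x)          ≡⟨ redirect-miss (root E u) (root E v) (root E x) miss ⟩
      root E x                                           ∎
      where open ≡-Reasoning

    root-edge : ∀ (E : List (Edge n)) u v → root ((u , v) ∷ E) u ≡ root ((u , v) ∷ E) v
    root-edge E u v = trans (redirect-source (root E u) (root E v)) (sym (redirect-hit (root E u) (root E v) (root E v) refl))

    Adj⇒root-≡ : ∀ (E : List (Edge n)) {a b} → Adj E a b → root E a ≡ root E b
    Adj⇒root-≡ ((u , v) ∷ E) (inj₁ (here refl)) = root-edge E u v
    Adj⇒root-≡ ((u , v) ∷ E) (inj₂ (here refl)) = sym (root-edge E u v)
    Adj⇒root-≡ ((u , v) ∷ E) (inj₁ (there m))   = cong (redirect _ _) (Adj⇒root-≡ E (inj₁ m))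
    Adj⇒root-≡ ((u , v) ∷ E) (inj₂ (there m))   = cong (redirect _ _) (Adj⇒root-≡ E (inj₂ m))

    Walk⇒root-≡ : ∀ (E : List (Edge n)) {a b} → Walk E a b → root E a ≡ root E b
    Walk⇒root-≡ E here       = refl
    Walk⇒root-≡ E (step x w) = trans (Adj⇒root-≡ E x) (Walk⇒root-≡ E w)

    root-≡⇒Walk : ∀ (E : List (Edge n)) a b → root E a ≡ root E b → Walk E a b
    root-≡⇒Walk []            a b refl = here
    root-≡⇒Walk ((u , v) ∷ E) a b eq = connect (root E a ≟ root E v) (root E b ≟ root E v)
      where
      connect : Dec (root E a ≡ root E v) → Dec (root E b ≡ root E v) → Walk ((u , v) ∷ E) a b
      connect (yes a↦v) (yes b↦v) = Walk-weaken (root-≡⇒Walk E a b (trans a↦v (sym b↦v)))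
      connect (yes a↦v) (no b↛v)  = Walk-++ (Walk-weaken (root-≡⇒Walk E a v a↦v)) (step (inj₂ (here refl))
        (Walk-weaken (root-≡⇒Walk E u b (trans (sym (redirect-hit _ _ _ a↦v)) (trans eq (redirect-miss _ _ _ b↛v))))))
      connect (no a↛v)  (yes b↦v) = Walk-++
        (Walk-weaken (root-≡⇒Walk E a u (trans (sym (redirect-miss _ _ _ a↛v)) (trans eq (redirect-hit _ _ _ b↦v)))))
        (step (inj₁ (here refl)) (Walk-weaken (root-≡⇒Walk E v b (sym b↦v))))
      connect (no a↛v)  (no b↛v)  =
        Walk-weaken (root-≡⇒Walk E a b (trans (sym (redirect-miss _ _ _ a↛v)) (trans eq (redirect-miss _ _ _ b↛v))))

    rootCount : List (Edge n) → ℕ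
    rootCount E = ∑[ x ∈ allFin n ] 𝟙 (root E x ≟ x)

    -- Joining two different components merges exactly one root into another.
    rootCount-∷ : ∀ (E : List (Edge n)) u v → ¬ root E u ≡ root E v → rootCount E ≡ rootCount ((u , v) ∷ E) + 1
    rootCount-∷ E u v separate = begin
      ∑[ x ∈ allFin n ] 𝟙 (root E x ≟ x)
        ≡⟨ ∑-cong (allFin n) (λ x → pointwise x (root E x ≟ q) (x ≟ q)) ⟩
      ∑[ x ∈ allFin n ] (𝟙 (redirect p q (root E x) ≟ x) + 𝟙 (x ≟ q) * 1)
        ≡⟨ ∑-+ (allFin n) _ _ ⟩
      rootCount ((u , v) ∷ E) + ∑[ x ∈ allFin n ] (𝟙 (x ≟ q) * 1)
        ≡⟨ cong (rootCount ((u , v) ∷ E) +_) (∑-point q (λ _ → 1)) ⟩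
      rootCount ((u , v) ∷ E) + 1 ∎
      where
      open ≡-Reasoning
      p = root E u
      q = root E v
      pointwise : ∀ x → Dec (root E x ≡ q) → Dec (x ≡ q) →
                  𝟙 (root E x ≟ x) ≡ 𝟙 (redirect p q (root E x) ≟ x) + 𝟙 (x ≟ q) * 1
      pointwise x (yes x↦q) (yes x≡q) = trans (𝟙-yes (root E x ≟ x) (trans x↦q (sym x≡q)))
        (sym (cong₂ _+_ (𝟙-no (redirect p q (root E x) ≟ x) (λ p≡x → separate (trans (trans (sym (redirect-hit p q (root E x) x↦q)) p≡x) x≡q)))
                        (cong (_* 1) (𝟙-yes (x ≟ q) x≡q))))
      pointwise x (yes x↦q) (no x≢q) = trans (𝟙-no (root E x ≟ x) (λ x↦x → x≢q (trans (sym x↦x) x↦q)))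
        (sym (cong₂ _+_ (𝟙-no (redirect p q (root E x) ≟ x) (λ p≡x → x≢q (q-is-x (trans (sym (redirect-hit p q (root E x) x↦q)) p≡x))))
                        (cong (_* 1) (𝟙-no (x ≟ q) x≢q))))
        where
        q-is-x : p ≡ x → x ≡ q
        q-is-x p≡x = trans (sym (trans (cong (root E) (sym p≡x)) (trans (root-idempotent E u) p≡x))) x↦q
      pointwise x (no x↛q) (yes x≡q) = ⊥-elim (x↛q (trans (cong (root E) x≡q) (root-idempotent E v)))
      pointwise x (no x↛q) (no x≢q) = trans (sym (+-identityʳ _))
        (cong₂ _+_ (cong (λ z → 𝟙 (z ≟ x)) (sym (redirect-miss p q (root E x) x↛q))) (sym (cong (_* 1) (𝟙-no (x ≟ q) x≢q))))

    rootCount+edges : ∀ (E : List (Edge n)) → IsSimple E → Acyclic E → rootCount E + length E ≡ n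
    rootCount+edges [] _ _ = trans (+-identityʳ _) (trans (∑-cong (allFin n) (λ x → 𝟙-yes (x ≟ x) refl))
                                                          (trans (∑-allFin-const n 1) (*-identityʳ n)))
    rootCount+edges ((u , v) ∷ E) (u≢v ∷ loopFree , fresh ∷ simple) acyclic = begin
      rootCount ((u , v) ∷ E) + suc (length E)  ≡⟨ sym (+-assoc (rootCount ((u , v) ∷ E)) 1 (length E)) ⟩
      rootCount ((u , v) ∷ E) + 1 + length E    ≡⟨ cong (_+ length E) (sym (rootCount-∷ E u v separate)) ⟩
      rootCount E + length E                    ≡⟨ rootCount+edges E (loopFree , simple) (acyclic ∘ HasCycle-weaken) ⟩
      n                                         ∎
      where
      open ≡-Reasoning
      separate : ¬ root E u ≡ root E v
      separate same = acyclic (Walk⇒HasCycle u≢v fresh (root-≡⇒Walk E u v same))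

  rootCount-connected : ∀ {k} (E : List (Edge (suc k))) → Connected E → rootCount E ≡ 1
  rootCount-connected {k} E connected =
    trans (∑-cong (allFin (suc k)) (λ x → trans (𝟙-cong (root E x ≟ x) (x ≟ root E zero) (mk⇔ to from)) (sym (*-identityʳ _))))
          (∑-point (root E zero) (λ _ → 1))
    where
    to : ∀ {x} → root E x ≡ x → x ≡ root E zero
    to {x} x↦x = trans (sym x↦x) (Walk⇒root-≡ E (connected x zero))
    from : ∀ {x} → x ≡ root E zero → root E x ≡ x
    from {x} x≡r = trans (cong (root E) x≡r) (trans (root-idempotent E zero) (sym x≡r))

  tree-edges : ∀ n (E : List (Edge n)) → 1 ≤ n → IsTree n E → suc (length E) ≡ n
  tree-edges (suc k) E _ (simple , connected , acyclic) =
    trans (cong (_+ length E) (sym (rootCount-connected E connected))) (rootCount+edges E simple acyclic)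

module DistanceClosedForms where

  open import Data.Nat using (_≤_; _<_; s≤s; ∣_-_∣)
  import Data.Nat as ℕ
  open import Data.Nat.Properties using (m<n⇒m<1+n; ≤-refl; ≤-total; <⇒≤; m≤n⇒m<n∨m≡n; m≤n⇒∣n-m∣≡n∸m; ∣-∣-comm)
  open import Data.Integer using (ℤ; +_; _+_; _*_; _-_)
  open import Data.Integer.Properties using (*-distribˡ-+; *-zeroʳ; *-identityˡ; +-assoc; +-comm; pos-+; pos-*; ⊖-≥; [+m]-[+n]≡m⊖n)
  open import Data.Integer.Tactic.RingSolver using (solve-∀)
  open Sums
  open Distances

  ∑ℤ : ℕ → (ℕ → ℤ) → ℤ
  ∑ℤ zero    f = + 0
  ∑ℤ (suc m) f = ∑ℤ m f + f m

  ∑ℤ-cong : ∀ m {f g : ℕ → ℤ} → (∀ a → a < m → f a ≡ g a) → ∑ℤ m f ≡ ∑ℤ m g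
  ∑ℤ-cong zero    eq = refl
  ∑ℤ-cong (suc m) eq = cong₂ _+_ (∑ℤ-cong m (λ a a<m → eq a (m<n⇒m<1+n a<m))) (eq m ≤-refl)

  ∑ℤ-*ˡ : ∀ m c (f : ℕ → ℤ) → ∑ℤ m (λ a → c * f a) ≡ c * ∑ℤ m f
  ∑ℤ-*ˡ zero    c f = sym (*-zeroʳ c)
  ∑ℤ-*ˡ (suc m) c f = trans (cong (_+ c * f m) (∑ℤ-*ˡ m c f)) (sym (*-distribˡ-+ c (∑ℤ m f) (f m)))

  ∑ℤ-suc : ∀ m (f : ℕ → ℤ) → ∑ℤ (suc m) f ≡ f 0 + ∑ℤ m (f ∘ suc)
  ∑ℤ-suc zero    f = +-comm (+ 0) (f 0)
  ∑ℤ-suc (suc m) f = trans (cong (_+ f (suc m)) (∑ℤ-suc m f)) (+-assoc (f 0) (∑ℤ m (f ∘ suc)) (f (suc m)))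

  pos-∑-allFin : ∀ m (g : ℕ → ℕ) → + ∑[ b ∈ allFin m ] g (toℕ b) ≡ ∑ℤ m (λ b → + g b)
  pos-∑-allFin zero    g = refl
  pos-∑-allFin (suc m) g = begin
    + ∑[ b ∈ allFin (suc m) ] g (toℕ b)            ≡⟨ cong +_ (∑-allFin-suc m (g ∘ toℕ)) ⟩
    + (g 0 ℕ.+ ∑[ b ∈ allFin m ] g (suc (toℕ b)))  ≡⟨ pos-+ (g 0) _ ⟩
    + g 0 + + ∑[ b ∈ allFin m ] g (suc (toℕ b))    ≡⟨ cong (λ s → + g 0 + s) (pos-∑-allFin m (g ∘ suc)) ⟩
    + g 0 + ∑ℤ m (λ b → + g (suc b))               ≡⟨ sym (∑ℤ-suc m (λ b → + g b)) ⟩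
    ∑ℤ (suc m) (λ b → + g b)                       ∎
    where open ≡-Reasoning

  -- At the call sites P and F are λ-terms, so that the ring solver (which does not unfold
  -- definitions) sees explicit polynomials in the two hypotheses.
  telescope : (P F : ℤ → ℤ → ℤ) (c : ℤ) → (∀ N → F (+ 0) N ≡ + 0) →
              (∀ x N → F x N + c * P x N ≡ F (+ 1 + x) N) →
              ∀ m N → c * ∑ℤ m (λ a → P (+ a) N) ≡ F (+ m) N
  telescope P F c F0 F-step zero    N = trans (*-zeroʳ c) (sym (F0 N))
  telescope P F c F0 F-step (suc m) N = begin
    c * (∑ℤ m (λ a → P (+ a) N) + P (+ m) N)     ≡⟨ *-distribˡ-+ c _ (P (+ m) N) ⟩
    c * ∑ℤ m (λ a → P (+ a) N) + c * P (+ m) N   ≡⟨ cong (_+ c * P (+ m) N) (telescope P F c F0 F-step m N) ⟩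
    F (+ m) N + c * P (+ m) N                    ≡⟨ F-step (+ m) N ⟩
    F (+ suc m) N                                ∎
    where open ≡-Reasoning

  pos-∸ : ∀ {a b} → b ≤ a → + (a ℕ.∸ b) ≡ + a - + b
  pos-∸ {a} {b} b≤a = trans (sym (⊖-≥ b≤a)) (sym ([+m]-[+n]≡m⊖n a b))

  pos-∣-∣ : ∀ {a b} → b ≤ a → + ∣ a - b ∣ ≡ + a - + b
  pos-∣-∣ b≤a = trans (cong +_ (m≤n⇒∣n-m∣≡n∸m b≤a)) (pos-∸ b≤a)

  pos-∣-∣-sq : ∀ a b → + (∣ a - b ∣ ℕ.* ∣ a - b ∣) ≡ (+ a - + b) * (+ a - + b)
  pos-∣-∣-sq a b with ≤-total b a
  ... | inj₁ b≤a = trans (pos-* ∣ a - b ∣ ∣ a - b ∣) (cong₂ _*_ (pos-∣-∣ b≤a) (pos-∣-∣ b≤a))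
  ... | inj₂ a≤b = trans (pos-* ∣ a - b ∣ ∣ a - b ∣)
                     (trans (cong₂ _*_ (subst (λ d → + d ≡ + b - + a) (∣-∣-comm b a) (pos-∣-∣ a≤b))
                                       (subst (λ d → + d ≡ + b - + a) (∣-∣-comm b a) (pos-∣-∣ a≤b)))
                            (flip-sq (+ a) (+ b)))
    where
    flip-sq : ∀ x y → (y - x) * (y - x) ≡ (x - y) * (x - y)
    flip-sq = solve-∀

  twice-∑-dist-≤ : ∀ N a → N ≤ a → + 2 * ∑ℤ N (λ b → + ∣ a - b ∣) ≡ + 2 * + N * + a - + N * + N + + N
  twice-∑-dist-≤ zero    a _   = refl
  twice-∑-dist-≤ (suc N) a N<a = begin
    + 2 * (∑ℤ N (λ b → + ∣ a - b ∣) + + ∣ a - N ∣)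
      ≡⟨ *-distribˡ-+ (+ 2) (∑ℤ N (λ b → + ∣ a - b ∣)) _ ⟩
    + 2 * ∑ℤ N (λ b → + ∣ a - b ∣) + + 2 * + ∣ a - N ∣
      ≡⟨ cong₂ (λ u v → u + + 2 * v) (twice-∑-dist-≤ N a (<⇒≤ N<a)) (pos-∣-∣ (<⇒≤ N<a)) ⟩
    (+ 2 * + N * + a - + N * + N + + N) + + 2 * (+ a - + N)
      ≡⟨ increment (+ N) (+ a) ⟩
    + 2 * + suc N * + a - + suc N * + suc N + + suc N ∎
    where
    open ≡-Reasoning
    increment : ∀ x y → (+ 2 * x * y - x * x + x) + + 2 * (y - x) ≡ + 2 * (+ 1 + x) * y - (+ 1 + x) * (+ 1 + x) + (+ 1 + x)
    increment = solve-∀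

  twice-∑-dist-< : ∀ N a → a < N →
    + 2 * ∑ℤ N (λ b → + ∣ a - b ∣) ≡ + 2 * + a * + a - + 2 * + a * + N + + 2 * + a + + N * + N - + N
  twice-∑-dist-< (suc N) a (s≤s a≤N) with m≤n⇒m<n∨m≡n a≤N
  ... | inj₁ a<N = begin
    + 2 * (∑ℤ N (λ b → + ∣ a - b ∣) + + ∣ a - N ∣)
      ≡⟨ *-distribˡ-+ (+ 2) (∑ℤ N (λ b → + ∣ a - b ∣)) _ ⟩
    + 2 * ∑ℤ N (λ b → + ∣ a - b ∣) + + 2 * + ∣ a - N ∣
      ≡⟨ cong₂ (λ u v → u + + 2 * v) (twice-∑-dist-< N a a<N) (trans (cong +_ (∣-∣-comm a N)) (pos-∣-∣ a≤N)) ⟩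
    (+ 2 * + a * + a - + 2 * + a * + N + + 2 * + a + + N * + N - + N) + + 2 * (+ N - + a)
      ≡⟨ increment (+ N) (+ a) ⟩
    + 2 * + a * + a - + 2 * + a * + suc N + + 2 * + a + + suc N * + suc N - + suc N ∎
    where
    open ≡-Reasoning
    increment : ∀ x y → (+ 2 * y * y - + 2 * y * x + + 2 * y + x * x - x) + + 2 * (x - y)
                   ≡ + 2 * y * y - + 2 * y * (+ 1 + x) + + 2 * y + (+ 1 + x) * (+ 1 + x) - (+ 1 + x)
    increment = solve-∀
  ... | inj₂ refl = begin
    + 2 * (∑ℤ a (λ b → + ∣ a - b ∣) + + ∣ a - a ∣)
      ≡⟨ *-distribˡ-+ (+ 2) (∑ℤ a (λ b → + ∣ a - b ∣)) _ ⟩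
    + 2 * ∑ℤ a (λ b → + ∣ a - b ∣) + + 2 * + ∣ a - a ∣
      ≡⟨ cong₂ (λ u v → u + + 2 * v) (twice-∑-dist-≤ a a ≤-refl) (pos-∣-∣ {a} ≤-refl) ⟩
    (+ 2 * + a * + a - + a * + a + + a) + + 2 * (+ a - + a)
      ≡⟨ increment (+ a) ⟩
    + 2 * + a * + a - + 2 * + a * + suc a + + 2 * + a + + suc a * + suc a - + suc a ∎
    where
    open ≡-Reasoning
    increment : ∀ y → (+ 2 * y * y - y * y + y) + + 2 * (y - y)
                 ≡ + 2 * y * y - + 2 * y * (+ 1 + y) + + 2 * y + (+ 1 + y) * (+ 1 + y) - (+ 1 + y)
    increment = solve-∀

  twice-rowDist : ∀ n a → a < n →
    + 2 * + ∑[ b ∈ allFin n ] ∣ a - toℕ b ∣ ≡ + 2 * + a * + a - + 2 * + a * + n + + 2 * + a + + n * + n - + n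
  twice-rowDist n a a<n = trans (cong (+ 2 *_) (pos-∑-allFin n (λ b → ∣ a - b ∣))) (twice-∑-dist-< n a a<n)

  totalDist-closed : ∀ n → + 6 * + totalDist n ≡ + 2 * + n * + n * + n - + 2 * + n
  totalDist-closed n = begin
    + 6 * + totalDist n
      ≡⟨ six (+ totalDist n) ⟩
    + 3 * (+ 2 * + totalDist n)
      ≡⟨ cong (λ t → + 3 * (+ 2 * t)) (pos-∑-allFin n (λ a → ∑[ b ∈ allFin n ] ∣ a - toℕ b ∣)) ⟩
    + 3 * (+ 2 * ∑ℤ n (λ a → + ∑[ b ∈ allFin n ] ∣ a - toℕ b ∣))
      ≡⟨ cong (+ 3 *_) (sym (∑ℤ-*ˡ n (+ 2) _)) ⟩
    + 3 * ∑ℤ n (λ a → + 2 * + ∑[ b ∈ allFin n ] ∣ a - toℕ b ∣)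
      ≡⟨ cong (+ 3 *_) (∑ℤ-cong n (twice-rowDist n)) ⟩
    + 3 * ∑ℤ n (λ a → + 2 * + a * + a - + 2 * + a * + n + + 2 * + a + + n * + n - + n)
      ≡⟨ telescope (λ a N → + 2 * a * a - + 2 * a * N + + 2 * a + N * N - N)
                   (λ m N → + 2 * m * m * m - + 3 * m * m * N + + 3 * m * N * N - + 2 * m)
                   (+ 3) solve-∀ solve-∀ n (+ n) ⟩
    + 2 * + n * + n * + n - + 3 * + n * + n * + n + + 3 * + n * + n * + n - + 2 * + n
      ≡⟨ simplify (+ n) ⟩
    + 2 * + n * + n * + n - + 2 * + n ∎
    where
    open ≡-Reasoning
    six : ∀ x → + 6 * x ≡ + 3 * (+ 2 * x)
    six = solve-∀
    simplify : ∀ ν → + 2 * ν * ν * ν - + 3 * ν * ν * ν + + 3 * ν * ν * ν - + 2 * ν ≡ + 2 * ν * ν * ν - + 2 * ν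
    simplify = solve-∀

  totalRowDistSq-closed : ∀ n → + 60 * + totalRowDistSq n ≡ + 7 * + n * + n * + n * + n * + n - + 15 * + n * + n * + n + + 8 * + n
  totalRowDistSq-closed n = begin
    + 60 * + totalRowDistSq n
      ≡⟨ cong (+ 60 *_) (pos-∑-allFin n (λ a → r a ℕ.* r a)) ⟩
    + 60 * ∑ℤ n (λ a → + (r a ℕ.* r a))
      ≡⟨ sym (∑ℤ-*ˡ n (+ 60) _) ⟩
    ∑ℤ n (λ a → + 60 * + (r a ℕ.* r a))
      ≡⟨ ∑ℤ-cong n (λ a a<n → trans (cong (+ 60 *_) (pos-* (r a) (r a)))
                               (trans (sixty (+ r a)) (cong (λ x → + 15 * (x * x)) (twice-rowDist n a a<n)))) ⟩
    ∑ℤ n (λ a → + 15 * ((+ 2 * + a * + a - + 2 * + a * ν + + 2 * + a + ν * ν - ν) * (+ 2 * + a * + a - + 2 * + a * ν + + 2 * + a + ν * ν - ν)))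
      ≡⟨ ∑ℤ-*ˡ n (+ 15) _ ⟩
    + 15 * ∑ℤ n (λ a → (+ 2 * + a * + a - + 2 * + a * ν + + 2 * + a + ν * ν - ν) * (+ 2 * + a * + a - + 2 * + a * ν + + 2 * + a + ν * ν - ν))
      ≡⟨ telescope (λ a N → (+ 2 * a * a - + 2 * a * N + + 2 * a + N * N - N) * (+ 2 * a * a - + 2 * a * N + + 2 * a + N * N - N))
           (λ m N → + 12 * m * m * m * m * m - + 30 * m * m * m * m * N + + 40 * m * m * m * N * N - + 20 * m * m * m
                    - + 30 * m * m * N * N * N + + 30 * m * m * N + + 15 * m * N * N * N * N - + 25 * m * N * N + + 8 * m)
           (+ 15) solve-∀ solve-∀ n (+ n) ⟩
    + 12 * ν * ν * ν * ν * ν - + 30 * ν * ν * ν * ν * ν + + 40 * ν * ν * ν * ν * ν - + 20 * ν * ν * ν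
      - + 30 * ν * ν * ν * ν * ν + + 30 * ν * ν * ν + + 15 * ν * ν * ν * ν * ν - + 25 * ν * ν * ν + + 8 * ν
      ≡⟨ simplify ν ⟩
    + 7 * ν * ν * ν * ν * ν - + 15 * ν * ν * ν + + 8 * ν ∎
    where
    open ≡-Reasoning
    ν = + n
    r : ℕ → ℕ
    r a = ∑[ b ∈ allFin n ] ∣ a - toℕ b ∣
    sixty : ∀ x → + 60 * (x * x) ≡ + 15 * ((+ 2 * x) * (+ 2 * x))
    sixty = solve-∀
    simplify : ∀ ν → + 12 * ν * ν * ν * ν * ν - + 30 * ν * ν * ν * ν * ν + + 40 * ν * ν * ν * ν * ν - + 20 * ν * ν * ν
                     - + 30 * ν * ν * ν * ν * ν + + 30 * ν * ν * ν + + 15 * ν * ν * ν * ν * ν - + 25 * ν * ν * ν + + 8 * ν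
                     ≡ + 7 * ν * ν * ν * ν * ν - + 15 * ν * ν * ν + + 8 * ν
    simplify = solve-∀

  totalDistSq-closed : ∀ n → + 6 * + totalDistSq n ≡ + n * + n * + n * + n - + n * + n
  totalDistSq-closed n = begin
    + 6 * + totalDistSq n
      ≡⟨ cong (+ 6 *_) (pos-∑-allFin n (λ a → ∑[ b ∈ allFin n ] (∣ a - toℕ b ∣ ℕ.* ∣ a - toℕ b ∣))) ⟩
    + 6 * ∑ℤ n (λ a → + ∑[ b ∈ allFin n ] (∣ a - toℕ b ∣ ℕ.* ∣ a - toℕ b ∣))
      ≡⟨ sym (∑ℤ-*ˡ n (+ 6) _) ⟩
    ∑ℤ n (λ a → + 6 * + ∑[ b ∈ allFin n ] (∣ a - toℕ b ∣ ℕ.* ∣ a - toℕ b ∣))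
      ≡⟨ ∑ℤ-cong n (λ a _ → inner a) ⟩
    ∑ℤ n (λ a → + 2 * ν * ν * ν - + 6 * ν * ν * + a - + 3 * ν * ν + + 6 * ν * + a * + a + + 6 * ν * + a + ν)
      ≡⟨ sym (*-identityˡ _) ⟩
    + 1 * ∑ℤ n (λ a → + 2 * ν * ν * ν - + 6 * ν * ν * + a - + 3 * ν * ν + + 6 * ν * + a * + a + + 6 * ν * + a + ν)
      ≡⟨ telescope (λ a N → + 2 * N * N * N - + 6 * N * N * a - + 3 * N * N + + 6 * N * a * a + + 6 * N * a + N)
                   (λ m N → + 2 * m * m * m * N - + 3 * m * m * N * N + + 2 * m * N * N * N - m * N)
                   (+ 1) solve-∀ solve-∀ n ν ⟩
    + 2 * ν * ν * ν * ν - + 3 * ν * ν * ν * ν + + 2 * ν * ν * ν * ν - ν * ν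
      ≡⟨ simplify ν ⟩
    ν * ν * ν * ν - ν * ν ∎
    where
    open ≡-Reasoning
    ν = + n
    inner : ∀ a → + 6 * + ∑[ b ∈ allFin n ] (∣ a - toℕ b ∣ ℕ.* ∣ a - toℕ b ∣)
                  ≡ + 2 * ν * ν * ν - + 6 * ν * ν * + a - + 3 * ν * ν + + 6 * ν * + a * + a + + 6 * ν * + a + ν
    inner a = begin
      + 6 * + ∑[ b ∈ allFin n ] (∣ a - toℕ b ∣ ℕ.* ∣ a - toℕ b ∣)
        ≡⟨ cong (+ 6 *_) (pos-∑-allFin n (λ b → ∣ a - b ∣ ℕ.* ∣ a - b ∣)) ⟩
      + 6 * ∑ℤ n (λ b → + (∣ a - b ∣ ℕ.* ∣ a - b ∣))
        ≡⟨ cong (+ 6 *_) (∑ℤ-cong n (λ b _ → pos-∣-∣-sq a b)) ⟩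
      + 6 * ∑ℤ n (λ b → (+ a - + b) * (+ a - + b))
        ≡⟨ telescope (λ b A → (A - b) * (A - b))
                     (λ m A → + 2 * m * m * m - + 6 * m * m * A - + 3 * m * m + + 6 * m * A * A + + 6 * m * A + m)
                     (+ 6) solve-∀ solve-∀ n (+ a) ⟩
      + 2 * ν * ν * ν - + 6 * ν * ν * + a - + 3 * ν * ν + + 6 * ν * + a * + a + + 6 * ν * + a + ν ∎
    simplify : ∀ ν → + 2 * ν * ν * ν * ν - + 3 * ν * ν * ν * ν + + 2 * ν * ν * ν * ν - ν * ν ≡ ν * ν * ν * ν - ν * ν
    simplify = solve-∀


module MomentAlgebra where

  open import Data.Integer using (ℤ; +_; _+_; _*_; _-_)
  open import Data.Integer.Properties using (pos-+; pos-*; *-cancelˡ-≡)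
  open import Data.Integer.Tactic.RingSolver using (solve-∀)
  open import Data.Nat using (_≤_; z≤n; s≤s; _!; _^_)
  import Data.Nat as ℕ
  import Data.Nat.Properties as ℕ
  open Sums
  open InjectiveSums
  open Distances
  open EdgeMoments
  open TreeEdges
  open DistanceClosedForms

  cong₃ : ∀ {A : Set} (f : A → A → A → A) {a a′ b b′ c c′} → a ≡ a′ → b ≡ b′ → c ≡ c′ → f a b c ≡ f a′ b′ c′
  cong₃ f refl refl refl = refl

  isolate₃ : ∀ {a b c d : ℤ} → a + b + c ≡ d → a ≡ d - b - c
  isolate₃ {a} {b} {c} refl = cancel a b c
    where
    cancel : ∀ a b c → a ≡ a + b + c - b - c
    cancel = solve-∀

  -- 180 B and 180 C in terms of the quantities 6 T, 6 Q, 60 R that have integral closed forms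
  scaled-triple : ∀ {B Q R : ℤ} → B + Q ≡ R → + 180 * B ≡ + 3 * (+ 60 * R) - + 30 * (+ 6 * Q)
  scaled-triple {B} {Q} refl = expand B Q
    where
    expand : ∀ B Q → + 180 * B ≡ + 3 * (+ 60 * (B + Q)) - + 30 * (+ 6 * Q)
    expand = solve-∀

  scaled-quad : ∀ {C B Q R T : ℤ} → B + Q ≡ R → C + (B + B) + (R + R) ≡ T * T →
                + 180 * C ≡ + 5 * ((+ 6 * T) * (+ 6 * T)) - + 12 * (+ 60 * R) + + 60 * (+ 6 * Q)
  scaled-quad {C} {B} {Q} {_} {T} refl hC = trans (cong (+ 180 *_) (isolate₃ {C} {B + B} {(B + Q) + (B + Q)} hC)) (expand B Q T)
    where
    expand : ∀ B Q T → + 180 * (T * T - (B + B) - ((B + Q) + (B + Q)))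
                       ≡ + 5 * ((+ 6 * T) * (+ 6 * T)) - + 12 * (+ 60 * (B + Q)) + + 60 * (+ 6 * Q)
    expand = solve-∀

  meanSquarePolynomial : ℤ → ℤ → ℤ
  meanSquarePolynomial ν K = + 4 * (ν - + 1) * (ν - + 1) * (+ 5 * ν + + 6) + (ν - + 4) * K

  -- n = 4 + t vertices and F = t!; N_k ordered edge pairs share k endpoints and have weight W_k, and
  -- T, Q, R, B, C are totalDist, totalDistSq, totalRowDistSq, distinctTripleDist, distinctQuadDist.
  second-moment-core : ∀ (t F N₁ : ℤ) {X N₀ N₂ m K W₀ W₁ W₂ C B Q R T : ℤ} → let ν = + 4 + t in
    X ≡ N₀ * W₀ + N₁ * W₁ + N₂ * W₂ →
    W₀ ≡ F * C → W₁ ≡ (+ 1 + t) * F * B → W₂ ≡ (+ 2 + t) * ((+ 1 + t) * F) * Q →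
    N₀ + N₁ + N₂ ≡ m * m → N₁ + + 2 * N₂ ≡ K → N₂ ≡ m → m ≡ + 3 + t →
    B + Q ≡ R → C + (B + B) + (R + R) ≡ T * T →
    + 6 * T ≡ + 2 * ν * ν * ν - + 2 * ν →
    + 6 * Q ≡ ν * ν * ν * ν - ν * ν →
    + 60 * R ≡ + 7 * ν * ν * ν * ν * ν - + 15 * ν * ν * ν + + 8 * ν →
    + 180 * X ≡ (ν + + 1) * (ν * ((+ 3 + t) * ((+ 2 + t) * ((+ 1 + t) * F)))) * meanSquarePolynomial ν K
  second-moment-core t F N₁ {N₀ = N₀} {C = C} {B} {Q} {R} {T} refl refl refl refl hN refl refl refl hB hC hT hQ hR = begin
      + 180 * (N₀ * (F * C) + N₁ * ((+ 1 + t) * F * B) + m * ((+ 2 + t) * ((+ 1 + t) * F) * Q))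
        ≡⟨ cong (λ N → + 180 * (N * (F * C) + N₁ * ((+ 1 + t) * F * B) + m * ((+ 2 + t) * ((+ 1 + t) * F) * Q))) (isolate₃ {N₀} {N₁} {m} hN) ⟩
      + 180 * (N₀′ * (F * C) + N₁ * ((+ 1 + t) * F * B) + m * ((+ 2 + t) * ((+ 1 + t) * F) * Q))
        ≡⟨ regroup N₀′ N₁ m F t C B Q ⟩
      N₀′ * F * (+ 180 * C) + N₁ * ((+ 1 + t) * F) * (+ 180 * B) + m * ((+ 2 + t) * ((+ 1 + t) * F)) * (+ 30 * (+ 6 * Q))
        ≡⟨ cong₂ (λ c b → N₀′ * F * c + N₁ * ((+ 1 + t) * F) * b + m * ((+ 2 + t) * ((+ 1 + t) * F)) * (+ 30 * (+ 6 * Q)))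
                 (scaled-quad {C} {B} {Q} {R} {T} hB hC) (scaled-triple {B} {Q} {R} hB) ⟩
      N₀′ * F * (+ 5 * ((+ 6 * T) * (+ 6 * T)) - + 12 * (+ 60 * R) + + 60 * (+ 6 * Q))
        + N₁ * ((+ 1 + t) * F) * (+ 3 * (+ 60 * R) - + 30 * (+ 6 * Q)) + m * ((+ 2 + t) * ((+ 1 + t) * F)) * (+ 30 * (+ 6 * Q))
        ≡⟨ cong₃ (λ T6 Q6 R60 → N₀′ * F * (+ 5 * (T6 * T6) - + 12 * R60 + + 60 * Q6)
                                 + N₁ * ((+ 1 + t) * F) * (+ 3 * R60 - + 30 * Q6) + m * ((+ 2 + t) * ((+ 1 + t) * F)) * (+ 30 * Q6))
                 hT hQ hR ⟩
      _
        ≡⟨ evaluate t F N₁ ⟩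
      (ν + + 1) * (ν * (m * ((+ 2 + t) * ((+ 1 + t) * F)))) * meanSquarePolynomial ν (N₁ + + 2 * m) ∎
    where
    open ≡-Reasoning
    ν = + 4 + t
    m = + 3 + t
    N₀′ = m * m - N₁ - m
    regroup : ∀ N₀ N₁ m F t C B Q →
      + 180 * (N₀ * (F * C) + N₁ * ((+ 1 + t) * F * B) + m * ((+ 2 + t) * ((+ 1 + t) * F) * Q))
        ≡ N₀ * F * (+ 180 * C) + N₁ * ((+ 1 + t) * F) * (+ 180 * B) + m * ((+ 2 + t) * ((+ 1 + t) * F)) * (+ 30 * (+ 6 * Q))
    regroup = solve-∀
    evaluate : ∀ t F N₁ →
      let ν   = + 4 + t
          m   = + 3 + t
          N₀  = m * m - N₁ - m
          T6  = + 2 * ν * ν * ν - + 2 * ν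
          Q6  = ν * ν * ν * ν - ν * ν
          R60 = + 7 * ν * ν * ν * ν * ν - + 15 * ν * ν * ν + + 8 * ν
      in
      N₀ * F * (+ 5 * (T6 * T6) - + 12 * R60 + + 60 * Q6) + N₁ * ((+ 1 + t) * F) * (+ 3 * R60 - + 30 * Q6)
        + m * ((+ 2 + t) * ((+ 1 + t) * F)) * (+ 30 * Q6)
      ≡ (ν + + 1) * (ν * (m * ((+ 2 + t) * ((+ 1 + t) * F))))
          * (+ 4 * (ν - + 1) * (ν - + 1) * (+ 5 * ν + + 6) + (ν - + 4) * (N₁ + + 2 * m))
    evaluate = solve-∀

  first-moment-core : ∀ (t F T : ℤ) → let ν = + 2 + t in
    + 6 * T ≡ + 2 * ν * ν * ν - + 2 * ν → + 3 * ((+ 1 + t) * (F * T)) ≡ ν * ((+ 1 + t) * F) * (ν * ν - + 1)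
  first-moment-core t F T hT = *-cancelˡ-≡ (+ 2) _ _ (begin
    + 2 * (+ 3 * ((+ 1 + t) * (F * T)))               ≡⟨ regroup t F T ⟩
    (+ 1 + t) * F * (+ 6 * T)                         ≡⟨ cong ((+ 1 + t) * F *_) hT ⟩
    (+ 1 + t) * F * (+ 2 * ν * ν * ν - + 2 * ν)       ≡⟨ factor t F ⟩
    + 2 * (ν * ((+ 1 + t) * F) * (ν * ν - + 1))       ∎)
    where
    open ≡-Reasoning
    ν = + 2 + t
    regroup : ∀ t F T → + 2 * (+ 3 * ((+ 1 + t) * (F * T))) ≡ (+ 1 + t) * F * (+ 6 * T)
    regroup = solve-∀
    factor : ∀ t F → let ν = + 2 + t in
      (+ 1 + t) * F * (+ 2 * ν * ν * ν - + 2 * ν) ≡ + 2 * (ν * ((+ 1 + t) * F) * (ν * ν - + 1))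
    factor = solve-∀

  pos-+₃ : ∀ a b c → + (a ℕ.+ b ℕ.+ c) ≡ + a + + b + + c
  pos-+₃ a b c = trans (pos-+ (a ℕ.+ b) c) (cong (_+ + c) (pos-+ a b))

  pos-*₃ : ∀ a b c → + (a ℕ.* b ℕ.* c) ≡ + a * + b * + c
  pos-*₃ a b c = trans (pos-* (a ℕ.* b) c) (cong (_* + c) (pos-* a b))

  second-moment-2 : ∀ (E : List (Edge 2)) → IsTree 2 E →
    + 180 * + injSum [] 2 (λ π → D E π ^ 2) ≡ (+ 2 + + 1) * + (2 !) * meanSquarePolynomial (+ 2) (+ sumDegSq 2 E)
  second-moment-2 E tree@(simple@(loopFree , _) , _) =
    subst₂ (λ x k → + 180 * + x ≡ (+ 2 + + 1) * + (2 !) * meanSquarePolynomial (+ 2) (+ k)) (sym X≡2) (sym K≡2) refl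
    where
    one-edge : length E ≡ 1
    one-edge = ℕ.suc-injective (tree-edges 2 E (s≤s z≤n) tree)
    N₂≡1 : pairCount E 2 ≡ 1
    N₂≡1 = trans (pairCount-two E simple) one-edge
    N₀+N₁≡0 : pairCount E 0 ℕ.+ pairCount E 1 ≡ 0
    N₀+N₁≡0 = ℕ.+-cancelʳ-≡ 1 _ 0 (trans (cong (pairCount E 0 ℕ.+ pairCount E 1 ℕ.+_) (sym N₂≡1))
      (trans (pairCount-total E loopFree) (cong (λ m → m ℕ.* m) one-edge)))
    X≡2 : injSum [] 2 (λ π → D E π ^ 2) ≡ 2
    X≡2 = trans (second-moment-decomposition E loopFree)
                (cong₃ (λ a b c → a ℕ.* pairWeight 2 0 ℕ.+ b ℕ.* pairWeight 2 1 ℕ.+ c ℕ.* pairWeight 2 2)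
                       (ℕ.m+n≡0⇒m≡0 (pairCount E 0) N₀+N₁≡0) (ℕ.m+n≡0⇒n≡0 (pairCount E 0) N₀+N₁≡0) N₂≡1)
    K≡2 : sumDegSq 2 E ≡ 2
    K≡2 = trans (sym (degree-pairCount E loopFree)) (cong₂ (λ b c → b ℕ.+ 2 ℕ.* c) (ℕ.m+n≡0⇒n≡0 (pairCount E 0) N₀+N₁≡0) N₂≡1)

  second-moment-3 : ∀ (E : List (Edge 3)) → IsTree 3 E →
    + 180 * + injSum [] 3 (λ π → D E π ^ 2) ≡ (+ 3 + + 1) * + (3 !) * meanSquarePolynomial (+ 3) (+ sumDegSq 3 E)
  second-moment-3 E tree@(simple@(loopFree , _) , _) =
    subst₂ (λ x k → + 180 * + x ≡ (+ 3 + + 1) * + (3 !) * meanSquarePolynomial (+ 3) (+ k)) (sym X≡44) (sym K≡6) refl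
    where
    open ≡-Reasoning
    two-edges : length E ≡ 2
    two-edges = ℕ.suc-injective (tree-edges 3 E (s≤s z≤n) tree)
    N₀≡0 : pairCount E 0 ≡ 0
    N₀≡0 = pairCount-zero-Fin3 E loopFree
    N₂≡2 : pairCount E 2 ≡ 2
    N₂≡2 = trans (pairCount-two E simple) two-edges
    N₁≡2 : pairCount E 1 ≡ 2
    N₁≡2 = ℕ.+-cancelʳ-≡ 2 _ 2 (begin
      pairCount E 1 ℕ.+ 2                                ≡⟨ cong₂ (λ a b → a ℕ.+ pairCount E 1 ℕ.+ b) (sym N₀≡0) (sym N₂≡2) ⟩
      pairCount E 0 ℕ.+ pairCount E 1 ℕ.+ pairCount E 2  ≡⟨ pairCount-total E loopFree ⟩
      length E ℕ.* length E                              ≡⟨ cong (λ m → m ℕ.* m) two-edges ⟩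
      4                                                  ∎)
    X≡44 : injSum [] 3 (λ π → D E π ^ 2) ≡ 44
    X≡44 = trans (second-moment-decomposition E loopFree)
                 (cong₃ (λ a b c → a ℕ.* pairWeight 3 0 ℕ.+ b ℕ.* pairWeight 3 1 ℕ.+ c ℕ.* pairWeight 3 2) N₀≡0 N₁≡2 N₂≡2)
    K≡6 : sumDegSq 3 E ≡ 6
    K≡6 = trans (sym (degree-pairCount E loopFree)) (cong₂ (λ b c → b ℕ.+ 2 ℕ.* c) N₁≡2 N₂≡2)

  second-moment-≥4 : ∀ t (E : List (Edge (4 ℕ.+ t))) → IsTree (4 ℕ.+ t) E → let n = 4 ℕ.+ t in
    + 180 * + injSum [] n (λ π → D E π ^ 2) ≡ (+ n + + 1) * + (n !) * meanSquarePolynomial (+ n) (+ sumDegSq n E)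
  second-moment-≥4 t E tree@(simple@(loopFree , _) , _) =
    trans (second-moment-core (+ t) (+ (t !)) (+ N₁) {N₀ = + N₀} {+ N₂} {+ m} {W₀ = + W 0} {+ W 1} {+ W 2}
                              {+ distinctQuadDist {n}} {+ distinctTripleDist {n}} {+ totalDistSq n} {+ totalRowDistSq n} {+ totalDist n}
                              hX (pos-* (t !) _) (pos-*₃ (suc t) (t !) _) hW₂ hN hK hN₂ hm hB hC
                              (totalDist-closed n) (totalDistSq-closed n) (totalRowDistSq-closed n))
          (cong (λ f → (+ n + + 1) * f * meanSquarePolynomial (+ n) (+ sumDegSq n E)) (sym pos-n!))
    where
    n = 4 ℕ.+ t
    N₀ = pairCount E 0
    N₁ = pairCount E 1
    N₂ = pairCount E 2
    m = length E
    W = pairWeight n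
    hX : + injSum [] n (λ π → D E π ^ 2) ≡ + N₀ * + W 0 + + N₁ * + W 1 + + N₂ * + W 2
    hX = trans (cong +_ (second-moment-decomposition E loopFree))
               (trans (pos-+₃ (N₀ ℕ.* W 0) (N₁ ℕ.* W 1) (N₂ ℕ.* W 2)) (cong₃ (λ a b c → a + b + c) (pos-* N₀ _) (pos-* N₁ _) (pos-* N₂ _)))
    hW₂ : + W 2 ≡ (+ 2 + + t) * ((+ 1 + + t) * + (t !)) * + totalDistSq n
    hW₂ = trans (cong (λ q → + ((2 ℕ.+ t) ! ℕ.* q)) (distinctPairDistSq≡totalDistSq {n}))
                (trans (pos-*₃ (2 ℕ.+ t) (suc t ℕ.* t !) _) (cong (λ f → + (2 ℕ.+ t) * f * + totalDistSq n) (pos-* (suc t) (t !))))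
    hN : + N₀ + + N₁ + + N₂ ≡ + m * + m
    hN = trans (sym (pos-+₃ N₀ N₁ N₂)) (trans (cong +_ (pairCount-total E loopFree)) (pos-* m m))
    hK : + N₁ + + 2 * + N₂ ≡ + sumDegSq n E
    hK = trans (sym (trans (pos-+ N₁ (2 ℕ.* N₂)) (cong (λ x → + N₁ + x) (pos-* 2 N₂)))) (cong +_ (degree-pairCount E loopFree))
    hN₂ : + N₂ ≡ + m
    hN₂ = cong +_ (pairCount-two E simple)
    hm : + m ≡ + 3 + + t
    hm = cong +_ (ℕ.suc-injective (tree-edges n E (s≤s z≤n) tree))
    hB : + distinctTripleDist {n} + + totalDistSq n ≡ + totalRowDistSq n
    hB = trans (sym (pos-+ (distinctTripleDist {n}) _)) (cong +_ (distinctTriple+distSq {n}))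
    B = distinctTripleDist {n}
    R = totalRowDistSq n
    hC : + distinctQuadDist {n} + (+ B + + B) + (+ R + + R) ≡ + totalDist n * + totalDist n
    hC = trans (sym (trans (pos-+₃ (distinctQuadDist {n}) (B ℕ.+ B) (R ℕ.+ R))
                           (cong₂ (λ b r → + distinctQuadDist {n} + b + r) (pos-+ B B) (pos-+ R R))))
               (trans (cong +_ (distinctQuad-identity {n})) (pos-* (totalDist n) (totalDist n)))
    pos-n! : + (n !) ≡ + n * ((+ 3 + + t) * ((+ 2 + + t) * ((+ 1 + + t) * + (t !))))
    pos-n! = trans (pos-* n ((3 ℕ.+ t) !)) (cong (+ n *_) (trans (pos-* (3 ℕ.+ t) ((2 ℕ.+ t) !))
               (cong (+ (3 ℕ.+ t) *_) (trans (pos-* (2 ℕ.+ t) ((1 ℕ.+ t) !)) (cong (+ (2 ℕ.+ t) *_) (pos-* (1 ℕ.+ t) (t !)))))))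

  second-moment : ∀ n (E : List (Edge n)) → IsTree n E → 1 ≤ n →
    + 180 * + injSum [] n (λ π → D E π ^ 2) ≡ (+ n + + 1) * + (n !) * meanSquarePolynomial (+ n) (+ sumDegSq n E)
  second-moment 1 []      _    _   = refl
  second-moment 1 (_ ∷ _) tree 1≤n = ⊥-elim (ℕ.0≢1+n (sym (ℕ.suc-injective (tree-edges 1 _ 1≤n tree))))
  second-moment 2 E tree _ = second-moment-2 E tree
  second-moment 3 E tree _ = second-moment-3 E tree
  second-moment (suc (suc (suc (suc t)))) E tree _ = second-moment-≥4 t E tree

  first-moment : ∀ n (E : List (Edge n)) → IsTree n E → 1 ≤ n →
    + 3 * + injSum [] n (D E) ≡ + (n !) * (+ n * + n - + 1)
  first-moment 1 []      _    _   = refl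
  first-moment 1 (_ ∷ _) tree 1≤n = ⊥-elim (ℕ.0≢1+n (sym (ℕ.suc-injective (tree-edges 1 _ 1≤n tree))))
  first-moment n@(suc (suc t)) E tree@((loopFree , _) , _) 1≤n = begin
    + 3 * + injSum [] n (D E)
      ≡⟨ cong (λ y → + 3 * + y) (trans (injSum-D E loopFree)
           (cong₂ (λ m d → m ℕ.* (t ! ℕ.* d)) (ℕ.suc-injective (tree-edges n E 1≤n tree)) (distinctPairDist≡totalDist {n}))) ⟩
    + 3 * + (suc t ℕ.* (t ! ℕ.* totalDist n))
      ≡⟨ cong (+ 3 *_) (trans (pos-* (suc t) _) (cong (λ x → + suc t * x) (pos-* (t !) _))) ⟩
    + 3 * ((+ 1 + + t) * (+ (t !) * + totalDist n))
      ≡⟨ first-moment-core (+ t) (+ (t !)) (+ totalDist n) (totalDist-closed n) ⟩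
    + n * ((+ 1 + + t) * + (t !)) * (+ n * + n - + 1)
      ≡⟨ cong (λ f → f * (+ n * + n - + 1)) (sym (trans (pos-* n ((1 ℕ.+ t) !)) (cong (λ x → + n * x) (pos-* (suc t) (t !))))) ⟩
    + (n !) * (+ n * + n - + 1) ∎
    where open ≡-Reasoning

module RationalForms where

  open import Data.Integer as ℤ using (ℤ; +_)
  open import Data.Integer.Properties using (pos-+; pos-*)
  open import Data.Integer.Tactic.RingSolver using (solve-∀)
  open import Data.Nat using (_≤_; _!; _^_; _∸_)
  import Data.Nat as ℕ
  open import Data.Nat.Properties using (*-identityʳ)
  open import Data.List.Properties using (length-map)
  open import Data.Rational using (ℚ; _/_; _+_; _-_; _*_; 1ℚ; toℚᵘ; fromℚᵘ)
  import Data.Rational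
  open import Data.Rational.Properties using (toℚᵘ-fromℚᵘ; toℚᵘ-homo-+; toℚᵘ-homo-*; toℚᵘ-homo‿-; toℚᵘ-injective; fromℚᵘ-cong)
  open import Data.Rational.Unnormalised as ℚᵘ using (ℚᵘ; mkℚᵘ; _≃_; *≡*)
  open import Data.Rational.Unnormalised.Properties using (≃-trans; ≃-sym; *-cong; +-cong; -‿cong)
  open Sums
  open InjectiveSums
  open EdgeMoments using (arrangement-count)
  open DistanceClosedForms using (pos-∸)
  open MomentAlgebra using (meanSquarePolynomial)

  formula : ℤ → ℤ → ℤ → ℤ → ℚ
  formula a A c K = (a / 45) * ((A / 1) + ((c / 4) - 1ℚ) * (K / 1))

  -- toℚᵘ of a formula; ℚᵘ arithmetic computes its numerator to a (4A + (c - 4)K) in the particular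
  -- unnormalised shape appearing in the cross-multiplications below, and its denominator to 180.
  formulaᵘ : ℤ → ℤ → ℤ → ℤ → ℚᵘ
  formulaᵘ a A c K = mkℚᵘ a 44 ℚᵘ.* (mkℚᵘ A 0 ℚᵘ.+ (mkℚᵘ c 3 ℚᵘ.- mkℚᵘ (+ 1) 0) ℚᵘ.* mkℚᵘ K 0)

  toℚᵘ-/ : ∀ p q → toℚᵘ (p / suc q) ≃ mkℚᵘ p q
  toℚᵘ-/ p q = toℚᵘ-fromℚᵘ (mkℚᵘ p q)

  toℚᵘ-formula : ∀ a A c K → toℚᵘ (formula a A c K) ≃ formulaᵘ a A c K
  toℚᵘ-formula a A c K =
    ≃-trans (toℚᵘ-homo-* (a / 45) _)
    (*-cong (toℚᵘ-/ a 44)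
    (≃-trans (toℚᵘ-homo-+ (A / 1) _)
    (+-cong (toℚᵘ-/ A 0)
    (≃-trans (toℚᵘ-homo-* ((c / 4) - 1ℚ) (K / 1))
    (*-cong (≃-trans (toℚᵘ-homo-+ (c / 4) _) (+-cong (toℚᵘ-/ c 3) (≃-trans (toℚᵘ-homo‿- 1ℚ) (-‿cong (toℚᵘ-/ (+ 1) 0)))))
            (toℚᵘ-/ K 0))))))

  E-rla-injSum : ∀ {n} (f : Vec (Fin n) n → ℕ) k → n ! ≡ suc k → E-rla f ≡ fromℚᵘ (mkℚᵘ (+ injSum [] n f) k)
  E-rla-injSum {n} f k n!≡ = begin
    mean (map f (arrangements n))                   ≡⟨ mean-of-length (map f (arrangements n)) (trans (length-map f (arrangements n)) count) ⟩
    + sum (map f (arrangements n)) / suc k          ≡⟨ cong (λ s → + s / suc k) (∑-filter (λ π → unique? (toList π)) (allVecs n n) f) ⟩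
    fromℚᵘ (mkℚᵘ (+ injSum [] n f) k)               ∎
    where
    open ≡-Reasoning
    count : length (arrangements n) ≡ suc k
    count = trans (length-filter (λ π → unique? (toList π)) (allVecs n n))
                  (trans (∑-cong (allVecs n n) (λ π → sym (*-identityʳ _))) (trans (arrangement-count {n}) n!≡))
    mean-of-length : ∀ (xs : List ℕ) → length xs ≡ suc k → mean xs ≡ + sum xs / suc k
    mean-of-length (x ∷ xs) refl = refl

  pos-[n-1]² : ∀ {n} → 1 ≤ n → + ((n ∸ 1) ^ 2) ≡ (+ n ℤ.- + 1) ℤ.* ((+ n ℤ.- + 1) ℤ.* + 1)
  pos-[n-1]² {n} 1≤n = trans (pos-* (n ∸ 1) _) (cong₂ ℤ._*_ (pos-∸ 1≤n) (trans (pos-* (n ∸ 1) 1) (cong (ℤ._* + 1) (pos-∸ 1≤n))))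

  pos-[n-1]²[5n+6] : ∀ {n} → 1 ≤ n →
    + ((n ∸ 1) ^ 2 ℕ.* (5 ℕ.* n ℕ.+ 6)) ≡ (+ n ℤ.- + 1) ℤ.* ((+ n ℤ.- + 1) ℤ.* + 1) ℤ.* (+ 5 ℤ.* + n ℤ.+ + 6)
  pos-[n-1]²[5n+6] {n} 1≤n =
    trans (pos-* ((n ∸ 1) ^ 2) _) (cong₂ ℤ._*_ (pos-[n-1]² 1≤n) (trans (pos-+ (5 ℕ.* n) 6) (cong (ℤ._+ + 6) (pos-* 5 n))))

  mean-square-from-moment : ∀ n K x k → 1 ≤ n → n ! ≡ suc k →
    + 180 ℤ.* + x ≡ (+ n ℤ.+ + 1) ℤ.* + (n !) ℤ.* meanSquarePolynomial (+ n) (+ K) →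
    fromℚᵘ (mkℚᵘ (+ x) k) ≡ formula (+ (n ℕ.+ 1)) (+ ((n ∸ 1) ^ 2 ℕ.* (5 ℕ.* n ℕ.+ 6))) (+ n) (+ K)
  mean-square-from-moment n K x k 1≤n n!≡1+k moment = toℚᵘ-injective
    (≃-trans (toℚᵘ-fromℚᵘ (mkℚᵘ (+ x) k))
    (≃-trans (*≡* (cross (+ x) (+ suc k) (+ n) (+ K) (pos-+ n 1) (pos-[n-1]²[5n+6] 1≤n)
                         (subst (λ f → + 180 ℤ.* + x ≡ (+ n ℤ.+ + 1) ℤ.* + f ℤ.* meanSquarePolynomial (+ n) (+ K)) n!≡1+k moment)))
             (≃-sym (toℚᵘ-formula (+ (n ℕ.+ 1)) (+ ((n ∸ 1) ^ 2 ℕ.* (5 ℕ.* n ℕ.+ 6))) (+ n) (+ K)))))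
    where
    cross : ∀ x s ν K {a A} → a ≡ ν ℤ.+ + 1 → A ≡ (ν ℤ.- + 1) ℤ.* ((ν ℤ.- + 1) ℤ.* + 1) ℤ.* (+ 5 ℤ.* ν ℤ.+ + 6) →
            + 180 ℤ.* x ≡ (ν ℤ.+ + 1) ℤ.* s ℤ.* meanSquarePolynomial ν K →
            x ℤ.* + 180 ≡ (a ℤ.* (A ℤ.* + 4 ℤ.+ (ν ℤ.* + 1 ℤ.+ ℤ.- (+ 1) ℤ.* + 4) ℤ.* K ℤ.* + 1)) ℤ.* s
    cross x s ν K refl refl h = trans (comm x) (trans h (reshape ν K s))
      where
      comm : ∀ x → x ℤ.* + 180 ≡ + 180 ℤ.* x
      comm = solve-∀
      reshape : ∀ ν K s → (ν ℤ.+ + 1) ℤ.* s ℤ.* (+ 4 ℤ.* (ν ℤ.- + 1) ℤ.* (ν ℤ.- + 1) ℤ.* (+ 5 ℤ.* ν ℤ.+ + 6) ℤ.+ (ν ℤ.- + 4) ℤ.* K)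
        ≡ ((ν ℤ.+ + 1) ℤ.* (((ν ℤ.- + 1) ℤ.* ((ν ℤ.- + 1) ℤ.* + 1) ℤ.* (+ 5 ℤ.* ν ℤ.+ + 6)) ℤ.* + 4
            ℤ.+ (ν ℤ.* + 1 ℤ.+ ℤ.- (+ 1) ℤ.* + 4) ℤ.* K ℤ.* + 1)) ℤ.* s
      reshape = solve-∀

  mean-from-moment : ∀ n y k → n ! ≡ suc k → + 3 ℤ.* + y ≡ + (n !) ℤ.* (+ n ℤ.* + n ℤ.- + 1) →
                     fromℚᵘ (mkℚᵘ (+ y) k) ≡ (+ n ℤ.* + n ℤ.- + 1) / 3
  mean-from-moment n y k n!≡1+k moment = fromℚᵘ-cong {mkℚᵘ (+ y) k} {mkℚᵘ (+ n ℤ.* + n ℤ.- + 1) 2}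
    (*≡* (trans (comm (+ y) (+ 3)) (trans (subst (λ f → + 3 ℤ.* + y ≡ + f ℤ.* (+ n ℤ.* + n ℤ.- + 1)) n!≡1+k moment)
                                          (comm (+ suc k) (+ n ℤ.* + n ℤ.- + 1)))))
    where
    comm : ∀ a b → a ℤ.* b ≡ b ℤ.* a
    comm = solve-∀

  variance-from-mean-square : ∀ n K → 1 ≤ n → let e = (+ n ℤ.* + n ℤ.- + 1) / 3 in
    formula (+ (n ℕ.+ 1)) (+ ((n ∸ 1) ^ 2 ℕ.* (5 ℕ.* n ℕ.+ 6))) (+ n) (+ K) - e * e
      ≡ formula (+ (n ℕ.+ 1)) (+ ((n ∸ 1) ^ 2)) (+ n) (+ K)
  variance-from-mean-square n K 1≤n = toℚᵘ-injective
    (≃-trans (toℚᵘ-homo-+ (formula a A ν (+ K)) (Data.Rational.- (e * e)))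
    (≃-trans (+-cong (toℚᵘ-formula a A ν (+ K)) (≃-trans (toℚᵘ-homo‿- (e * e)) (-‿cong (≃-trans (toℚᵘ-homo-* e e) (*-cong (toℚᵘ-/ e′ 2) (toℚᵘ-/ e′ 2))))))
    (≃-trans (*≡* (cross ν (+ K) (pos-+ n 1) (pos-[n-1]²[5n+6] 1≤n) (pos-[n-1]² 1≤n)))
             (≃-sym (toℚᵘ-formula a A₂ ν (+ K))))))
    where
    ν = + n
    a = + (n ℕ.+ 1)
    A = + ((n ∸ 1) ^ 2 ℕ.* (5 ℕ.* n ℕ.+ 6))
    A₂ = + ((n ∸ 1) ^ 2)
    e′ = + n ℤ.* + n ℤ.- + 1
    e = e′ / 3
    cross : ∀ c K {a A A₂} → a ≡ c ℤ.+ + 1 → A ≡ (c ℤ.- + 1) ℤ.* ((c ℤ.- + 1) ℤ.* + 1) ℤ.* (+ 5 ℤ.* c ℤ.+ + 6) →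
            A₂ ≡ (c ℤ.- + 1) ℤ.* ((c ℤ.- + 1) ℤ.* + 1) →
            ((a ℤ.* (A ℤ.* + 4 ℤ.+ (c ℤ.* + 1 ℤ.+ ℤ.- (+ 1) ℤ.* + 4) ℤ.* K ℤ.* + 1)) ℤ.* + 9
              ℤ.+ ℤ.- ((c ℤ.* c ℤ.- + 1) ℤ.* (c ℤ.* c ℤ.- + 1)) ℤ.* + 180) ℤ.* + 180
            ≡ (a ℤ.* (A₂ ℤ.* + 4 ℤ.+ (c ℤ.* + 1 ℤ.+ ℤ.- (+ 1) ℤ.* + 4) ℤ.* K ℤ.* + 1)) ℤ.* + 1620
    cross c K refl refl refl = identity c K
      where
      identity : ∀ c K →
        (((c ℤ.+ + 1) ℤ.* (((c ℤ.- + 1) ℤ.* ((c ℤ.- + 1) ℤ.* + 1) ℤ.* (+ 5 ℤ.* c ℤ.+ + 6)) ℤ.* + 4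
            ℤ.+ (c ℤ.* + 1 ℤ.+ ℤ.- (+ 1) ℤ.* + 4) ℤ.* K ℤ.* + 1)) ℤ.* + 9
          ℤ.+ ℤ.- ((c ℤ.* c ℤ.- + 1) ℤ.* (c ℤ.* c ℤ.- + 1)) ℤ.* + 180) ℤ.* + 180
        ≡ ((c ℤ.+ + 1) ℤ.* (((c ℤ.- + 1) ℤ.* ((c ℤ.- + 1) ℤ.* + 1)) ℤ.* + 4
            ℤ.+ (c ℤ.* + 1 ℤ.+ ℤ.- (+ 1) ℤ.* + 4) ℤ.* K ℤ.* + 1)) ℤ.* + 1620
      identity = solve-∀

open import Data.Nat using (_≤_; _^_; _∸_; _!)
import Data.Nat as ℕ
open import Data.Nat.Properties using (suc-pred; _!≢0)
open import Data.Integer as ℤ using (+_)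
open import Data.Rational using (_/_; _+_; _-_; _*_; 1ℚ)
open InjectiveSums using (injSum)
open MomentAlgebra using (second-moment; first-moment)
open RationalForms

mainTheorem7 : (n : ℕ) → 1 ≤ n → (E : List (Edge n)) → IsTree n E →
    (E-rla (λ π → D E π ^ 2)
      ≡ (+ (n ℕ.+ 1) / 45) * ((+ ((n ∸ 1) ^ 2 ℕ.* (5 ℕ.* n ℕ.+ 6)) / 1)
          + ((+ n / 4) - 1ℚ) * (+ sumDegSq n E / 1)))
    × (V-rla (D E)
      ≡ (+ (n ℕ.+ 1) / 45) * ((+ ((n ∸ 1) ^ 2) / 1)
          + ((+ n / 4) - 1ℚ) * (+ sumDegSq n E / 1)))
mainTheorem7 n 1≤n E tree = mean-square , variance
  where
  k = ℕ.pred (n !)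
  n!≡1+k : n ! ≡ suc k
  n!≡1+k = sym (suc-pred (n !) {{n !≢0}})
  K = sumDegSq n E
  mean-square : E-rla (λ π → D E π ^ 2) ≡ formula (+ (n ℕ.+ 1)) (+ ((n ∸ 1) ^ 2 ℕ.* (5 ℕ.* n ℕ.+ 6))) (+ n) (+ K)
  mean-square = trans (E-rla-injSum (λ π → D E π ^ 2) k n!≡1+k)
                      (mean-square-from-moment n K (injSum [] n (λ π → D E π ^ 2)) k 1≤n n!≡1+k (second-moment n E tree 1≤n))
  mean-length : E-rla (D E) ≡ (+ n ℤ.* + n ℤ.- + 1) / 3
  mean-length = trans (E-rla-injSum (D E) k n!≡1+k) (mean-from-moment n (injSum [] n (D E)) k n!≡1+k (first-moment n E tree 1≤n))
  variance : V-rla (D E) ≡ formula (+ (n ℕ.+ 1)) (+ ((n ∸ 1) ^ 2)) (+ n) (+ K)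
  variance = trans (cong₂ (λ s e → s - e * e) mean-square mean-length) (variance-from-mean-square n K 1≤n)
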